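{- Every tree $T$ belonging to the family $\mathcal{T}$ defined in the context satisfies $\gamma_2(T)=\alpha_2(T)$.
   Context: All graphs are finite and simple. For a graph $G$, a set $S\subseteq V(G)$ is a $2$-dominating set if every vertex of $G$ not in $S$ is adjacent to at least two vertices of $S$, and $S$ is a $2$-independent set if every vertex of $S$ is adjacent to at most one vertex of $S$. $\gamma_2(G)$ is the minimum cardinality of a $2$-dominating set of $G$ and $\alpha_2(G)$ is the maximum cardinality of a $2$-independent set of $G$. Special trees. Each of the following fifteen trees has exactly one vertex colored white, all other vertices colored black, and some designated vertices. (A "path $x_1\dots x_k$" has edges $x_ix_{i+1}$.) $T_1$: path $x_1x_2x_3$; $x_2$ white; $v=x_2$. $T_2$: path $x_1x_2x_3$; $x_3$ white; $v=x_3$. $T_3$: path $x_1x_2x_3x_4$; $x_4$ white; $v=x_2$. $T_4$: path $x_1x_2x_3x_4$; $x_2$ white; $v=x_4$. $T_5$: path $x_1\dots x_5$; $x_2$ white; $v=x_2$. $T_6$: path $x_1\dots x_5$; $x_5$ white; $v_1=x_1$, $v_2=v=x_5$. $T_7$: path $x_1\dots x_6$; $x_6$ white; $v=x_4$. $T_8$: path $x_1\dots x_6$; $x_2$ white; $v=x_2$. $T_9$: path $x_1\dots x_7$; $x_7$ white; $v=x_7$. $T_{10}$: path $x_1\dots x_7$; $x_4$ white; $v=x_4$. $T_{11}$: path $x_1\dots x_6$ plus a vertex $y$ adjacent to $x_2$; $x_2$ white; $v=x_6$. $T_{12}$: path $x_1\dots x_6$ plus a vertex $y$ adjacent to $x_3$;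 $x_2$ white; $v=y$. $T_{13}$: the same tree and coloring as $T_{12}$, but with $v=x_1$. $T_{14}$: path $x_1\dots x_6$ plus a vertex $y_1$ adjacent to $x_2$ and a vertex $y_2$ adjacent to $x_3$; $x_1$ white; $v=v_1=x_1$, $v_2=x_2$. $T_{15}$: path $x_1x_2x_3x_4$ plus a vertex $y_1$ adjacent to $x_2$, a vertex $y_2$ adjacent to $x_3$, and two vertices $y_3,y_4$ adjacent to $x_4$; $x_4$ white; $v=x_1$. PDI-subtree. A tree $T'$ contains a special tree $T_{\rm pdi}$ as a PDI-subtree if there is a set $U\subseteq V(T')$ and an isomorphism $\varphi$ from $T_{\rm pdi}$ onto the induced subgraph $T'[U]$ such that every black vertex $x$ of $T_{\rm pdi}$ satisfies $\deg_{T'}(\varphi(x))=\deg_{T_{\rm pdi}}(x)$; the designated vertices $v,v_1,v_2$ of this PDI-subtree are the images under $\varphi$ of the designated vertices of $T_{\rm pdi}$. Operations producing a tree $T$ from a tree $T'$ (all vertices $u,u_1,u_2,u_3$ are new): $\mathcal{O}_1$: for a PDI-subtree $T_{\rm pdi}\in\{T_1,T_2,T_8\}$ of $T'$ with designated vertex $v$, add a vertex $u$ and the edge $vu$. $\mathcal{O}_2$: for a PDI-subtree $T_{\rm pdi}\in\{T_4,T_{11},T_{12},T_{13},T_{15}\}$ of $T'$ with designated vertex $v$, add a path $u_1u_2$ and the edge $vu_1$. $\mathcal{O}_3$: for an arbitrary vertex $v$ of $T'$, add a path $u_1u_2u_3$ and the edge $vu_2$. $\mathcal{O}_4$: for a PDI-subtree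 $T_{\rm pdi}\in\{T_1,T_2,T_3,T_5,T_6,T_7,T_9,T_{10}\}$ of $T'$ with designated vertex $v$, add a path $u_1u_2u_3$ and the edge $vu_1$. $\mathcal{O}_5$: for a PDI-subtree $T_6$ of $T'$ with designated vertices $v_1,v_2$, add a path $u_1u_3$ and the edge $v_1u_1$, and add a vertex $u_2$ and the edge $v_2u_2$. $\mathcal{O}_6$: for a PDI-subtree $T_{14}$ of $T'$ with designated vertices $v_1,v_2$, remove the edge $v_1v_2$, add a path $u_1u_2u_3$ and the edges $v_1u_1$ and $v_2u_2$. $\mathcal{T}$ is the family of trees that contains all trees of order at most $4$ and is closed under Operations $\mathcal{O}_1,\dots,\mathcal{O}_6$ (i.e., the trees obtainable from a tree of order at most $4$ by a finite sequence of these operations). -}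

module Defs where

open import Data.Bool using (Bool; true; false; _∧_; _∨_; not; if_then_else_)
open import Data.Nat using (ℕ; zero; suc; _+_; _≤_; _≡ᵇ_)
open import Data.Fin using (Fin; toℕ; splitAt; #_) renaming (_≟_ to _≟ᶠ_)
open import Data.Fin.Subset using (Subset; ∣_∣)
open import Data.Fin.Permutation using (Permutation; _⟨$⟩ʳ_)
open import Data.Vec using (lookup)
open import Data.List using (List; []; _∷_; _++_; length; filterᵇ)
open import Data.Bool.ListAction using (any)
open import Data.List.Relation.Unary.Unique.Propositional using (Unique)
open import Data.Product using (Σ; _×_; _,_)
open import Data.Sum using (_⊎_; inj₁; inj₂)
open import Data.Unit using (⊤)
open import Relation.Nullary using (¬_; ⌊_⌋)
open import Relation.Binary.PropositionalEquality using (_≡_; _≢_)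
open import Relation.Binary.Construct.Closure.ReflexiveTransitive using (Star)
open import Function.Definitions using (Injective)
open import Data.List using (allFin)

Graph : ℕ → Set
Graph n = Fin n → Fin n → Bool

Adj : ∀ {n} → Graph n → Fin n → Fin n → Set
Adj G a b = G a b ≡ true

countᵛ : ∀ {n} → (Fin n → Bool) → ℕ
countᵛ {n} p = length (filterᵇ p (allFin n))

deg : ∀ {n} → Graph n → Fin n → ℕ
deg G x = countᵛ (G x)

IsSimple : ∀ {n} → Graph n → Set
IsSimple G = (∀ a b → G a b ≡ G b a) × (∀ a → G a a ≡ false)

Connected : ∀ {n} → Graph n → Set
Connected G = ∀ a b → Star (Adj G) a b

Chain : ∀ {n} → Graph n → List (Fin n) → Set
Chain G [] = ⊤
Chain G (x ∷ []) = ⊤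
Chain G (x ∷ y ∷ r) = Adj G x y × Chain G (y ∷ r)

HasCycle : ∀ {n} → Graph n → Set
HasCycle {n} G = Σ (Fin n) λ x → Σ (List (Fin n)) λ c →
  Unique (x ∷ c) × 2 ≤ length c × Chain G (x ∷ c ++ x ∷ [])

IsTree : ∀ {n} → Graph n → Set
IsTree {n} G = IsSimple G × 1 ≤ n × Connected G × ¬ HasCycle G

_∈ˢ_ : ∀ {n} → Fin n → Subset n → Set
x ∈ˢ S = lookup S x ≡ true

nbrsIn : ∀ {n} → Graph n → Subset n → Fin n → ℕ
nbrsIn G S x = countᵛ (λ y → G x y ∧ lookup S y)

TwoDominating : ∀ {n} → Graph n → Subset n → Set
TwoDominating G S = ∀ x → ¬ (x ∈ˢ S) → 2 ≤ nbrsIn G S x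

TwoIndependent : ∀ {n} → Graph n → Subset n → Set
TwoIndependent G S = ∀ x → x ∈ˢ S → nbrsIn G S x ≤ 1

IsGamma2 : ∀ {n} → Graph n → ℕ → Set
IsGamma2 {n} G k =
  (Σ (Subset n) λ S → TwoDominating G S × ∣ S ∣ ≡ k) ×
  (∀ S → TwoDominating G S → k ≤ ∣ S ∣)

IsAlpha2 : ∀ {n} → Graph n → ℕ → Set
IsAlpha2 {n} G k =
  (Σ (Subset n) λ S → TwoIndependent G S × ∣ S ∣ ≡ k) ×
  (∀ S → TwoIndependent G S → ∣ S ∣ ≤ k)

-- Special trees (vertex x_i has index i-1; extra vertices y_j follow)

record SpecialTree : Set where
  field
    size  : ℕ
    adj   : Graph size
    white : Fin size
open SpecialTree public

fromEdges : ∀ {k} → List (ℕ × ℕ) → Graph k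
fromEdges es a b = any (λ { (i , j) →
  ((toℕ a ≡ᵇ i) ∧ (toℕ b ≡ᵇ j)) ∨ ((toℕ a ≡ᵇ j) ∧ (toℕ b ≡ᵇ i)) }) es

path3 path4 path5 path6 path7 : List (ℕ × ℕ)
path3 = (0 , 1) ∷ (1 , 2) ∷ []
path4 = path3 ++ (2 , 3) ∷ []
path5 = path4 ++ (3 , 4) ∷ []
path6 = path5 ++ (4 , 5) ∷ []
path7 = path6 ++ (5 , 6) ∷ []

mkST : (k : ℕ) → List (ℕ × ℕ) → Fin k → SpecialTree
mkST k es w = record { size = k ; adj = fromEdges es ; white = w }

T1 T2 T3 T4 T5 T6 T7 T8 T9 T10 T11 T12 T13 T14 T15 : SpecialTree
T1  = mkST 3 path3 (# 1)
T2  = mkST 3 path3 (# 2)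
T3  = mkST 4 path4 (# 3)
T4  = mkST 4 path4 (# 1)
T5  = mkST 5 path5 (# 1)
T6  = mkST 5 path5 (# 4)
T7  = mkST 6 path6 (# 5)
T8  = mkST 6 path6 (# 1)
T9  = mkST 7 path7 (# 6)
T10 = mkST 7 path7 (# 3)
-- y (index 6) adjacent to x₂ (index 1)
T11 = mkST 7 (path6 ++ (1 , 6) ∷ []) (# 1)
-- y (index 6) adjacent to x₃ (index 2)
T12 = mkST 7 (path6 ++ (2 , 6) ∷ []) (# 1)
T13 = T12
-- y₁ (6) adjacent to x₂ (1), y₂ (7) adjacent to x₃ (2)
T14 = mkST 8 (path6 ++ (1 , 6) ∷ (2 , 7) ∷ []) (# 0)
-- y₁ (4) ~ x₂ (1), y₂ (5) ~ x₃ (2), y₃ (6), y₄ (7) ~ x₄ (3)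
T15 = mkST 8 (path4 ++ (1 , 4) ∷ (2 , 5) ∷ (3 , 6) ∷ (3 , 7) ∷ []) (# 3)

record PDI {n} (P : SpecialTree) (G : Graph n) : Set where
  field
    φ       : Fin (size P) → Fin n
    φ-inj   : Injective _≡_ _≡_ φ
    induced : ∀ a b → G (φ a) (φ b) ≡ adj P a b
    black   : ∀ x → x ≢ white P → deg G (φ x) ≡ deg (adj P) x
open PDI public

data Allowed₁ : (P : SpecialTree) → Fin (size P) → Set where
  a-T1 : Allowed₁ T1 (# 1)
  a-T2 : Allowed₁ T2 (# 2)
  a-T8 : Allowed₁ T8 (# 1)

data Allowed₂ : (P : SpecialTree) → Fin (size P) → Set where
  a-T4  : Allowed₂ T4 (# 3)
  a-T11 : Allowed₂ T11 (# 5)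
  a-T12 : Allowed₂ T12 (# 6)
  a-T13 : Allowed₂ T13 (# 0)
  a-T15 : Allowed₂ T15 (# 0)

data Allowed₄ : (P : SpecialTree) → Fin (size P) → Set where
  a-T1  : Allowed₄ T1 (# 1)
  a-T2  : Allowed₄ T2 (# 2)
  a-T3  : Allowed₄ T3 (# 1)
  a-T5  : Allowed₄ T5 (# 1)
  a-T6  : Allowed₄ T6 (# 4)
  a-T7  : Allowed₄ T7 (# 3)
  a-T9  : Allowed₄ T9 (# 6)
  a-T10 : Allowed₄ T10 (# 3)

-- Extending a graph on Fin n by m new vertices (new vertex u_{j+1} = index n + j)

extend : ∀ {n} m → Graph n → (Fin n → Fin m → Bool) → Graph m → Graph (n + m)
extend {n} m G C H a b with splitAt n a | splitAt n b
... | inj₁ x | inj₁ y = G x y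
... | inj₁ x | inj₂ j = C x j
... | inj₂ i | inj₁ y = C y i
... | inj₂ i | inj₂ j = H i j

_≡ᶠ_ : ∀ {k} → Fin k → Fin k → Bool
a ≡ᶠ b = ⌊ a ≟ᶠ b ⌋

H₁ : Graph 1
H₁ _ _ = false

H₂ : Graph 2
H₂ = fromEdges ((0 , 1) ∷ [])

H₃ : Graph 3
H₃ = fromEdges path3

H₃′ : Graph 3
H₃′ = fromEdges ((0 , 2) ∷ [])

op₁ : ∀ {n} → Graph n → Fin n → Graph (n + 1)
op₁ G v = extend 1 G (λ x _ → x ≡ᶠ v) H₁

op₂ : ∀ {n} → Graph n → Fin n → Graph (n + 2)
op₂ G v = extend 2 G (λ x j → (x ≡ᶠ v) ∧ (j ≡ᶠ (# 0))) H₂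

op₃ : ∀ {n} → Graph n → Fin n → Graph (n + 3)
op₃ G v = extend 3 G (λ x j → (x ≡ᶠ v) ∧ (j ≡ᶠ (# 1))) H₃

op₄ : ∀ {n} → Graph n → Fin n → Graph (n + 3)
op₄ G v = extend 3 G (λ x j → (x ≡ᶠ v) ∧ (j ≡ᶠ (# 0))) H₃

op₅ : ∀ {n} → Graph n → Fin n → Fin n → Graph (n + 3)
op₅ G v₁ v₂ = extend 3 G
  (λ x j → ((x ≡ᶠ v₁) ∧ (j ≡ᶠ (# 0))) ∨ ((x ≡ᶠ v₂) ∧ (j ≡ᶠ (# 1)))) H₃′

removeEdge : ∀ {n} → Graph n → Fin n → Fin n → Graph n
removeEdge G v₁ v₂ a b =
  G a b ∧ not (((a ≡ᶠ v₁) ∧ (b ≡ᶠ v₂)) ∨ ((a ≡ᶠ v₂) ∧ (b ≡ᶠ v₁)))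

op₆ : ∀ {n} → Graph n → Fin n → Fin n → Graph (n + 3)
op₆ G v₁ v₂ = extend 3 (removeEdge G v₁ v₂)
  (λ x j → ((x ≡ᶠ v₁) ∧ (j ≡ᶠ (# 0))) ∨ ((x ≡ᶠ v₂) ∧ (j ≡ᶠ (# 1)))) H₃

-- The family 𝒯 (closed under isomorphism / relabelling)

data InT : (n : ℕ) → Graph n → Set where
  base : ∀ {n} (G : Graph n) → n ≤ 4 → IsTree G → InT n G
  relabel : ∀ {n} {G : Graph n} (H : Graph n) (π : Permutation n n) →
    (∀ a b → H a b ≡ G (π ⟨$⟩ʳ a) (π ⟨$⟩ʳ b)) → InT n G → InT n H
  O₁ : ∀ {n} {G : Graph n} (P : SpecialTree) (v : Fin (size P)) →
    Allowed₁ P v → (e : PDI P G) → InT n G → InT (n + 1) (op₁ G (φ e v))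
  O₂ : ∀ {n} {G : Graph n} (P : SpecialTree) (v : Fin (size P)) →
    Allowed₂ P v → (e : PDI P G) → InT n G → InT (n + 2) (op₂ G (φ e v))
  O₃ : ∀ {n} {G : Graph n} (v : Fin n) → InT n G → InT (n + 3) (op₃ G v)
  O₄ : ∀ {n} {G : Graph n} (P : SpecialTree) (v : Fin (size P)) →
    Allowed₄ P v → (e : PDI P G) → InT n G → InT (n + 3) (op₄ G (φ e v))
  -- T₆: v₁ = x₁ (index 0), v₂ = x₅ (index 4)
  O₅ : ∀ {n} {G : Graph n} (e : PDI T6 G) → InT n G →
    InT (n + 3) (op₅ G (φ e (# 0)) (φ e (# 4)))
  -- T₁₄: v₁ = x₁ (index 0), v₂ = x₂ (index 1)
  O₆ : ∀ {n} {G : Graph n} (e : PDI T14 G) → InT n G →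
    InT (n + 3) (op₆ G (φ e (# 0)) (φ e (# 1)))

module Submission where

-- Trees on at most four vertices are settled by a
-- certified exhaustive check.  Each operation Oᵢ acts locally: around its PDI-subtree (around
-- the vertex v for O₃) the tree is glued from a context and a small port graph meeting the
-- context only in one port vertex, the white vertex; that the black vertices keep their degree
-- is exactly what confines the connection to the port.  The operation replaces the port graph
-- L₁ by a larger L₂.  When L₁ and L₂ are exchangeable at cost a (every locally 2-dominating or
-- 2-independent set of one, for each number c ≤ 2 of outside neighbours of the port, trades
-- for one of the other that is a vertices larger, resp. smaller), both γ₂ and α₂ grow by a,
-- so γ₂ = α₂ is preserved.  Exchangeability of the concrete pairs is decided by computation.

open import Defs
open import Data.Bool using (Bool; true; false; _∧_; _∨_; not; if_then_else_; T)
open import Data.Bool.Properties using (T-∧; T-≡; ∧-assoc; ∧-comm; ∨-comm; ∧-identityʳ; ∧-zeroʳ)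
  renaming (_≟_ to _≟ᵇ_)
open import Data.Nat using (ℕ; zero; suc; _+_; _≤_; _<ᵇ_; _⊓_; z≤n; s≤s)
open import Data.Nat.Properties using (_≤?_; ≤-refl; ≤-trans; ≤-antisym; ≤-total; +-comm; +-assoc;
  +-identityʳ; +-monoʳ-≤; +-monoˡ-≤; +-cancelʳ-≡; m≤n+m; m+n≡0⇒m≡0; m+n≡0⇒n≡0; m⊓n≤m; m⊓n≤n;
  m≤n⇒m⊓n≡m; m≥n⇒m⊓n≡n; +-0-commutativeMonoid; module ≤-Reasoning) renaming (_≟_ to _≟ℕ_)
open import Data.Fin using (Fin; zero; suc; _↑ˡ_; _↑ʳ_; splitAt; #_)
open import Data.Fin.Properties using (splitAt-↑ˡ; splitAt-↑ʳ; splitAt⁻¹-↑ˡ; splitAt⁻¹-↑ʳ; ↑ˡ-injective)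
  renaming (_≟_ to _≟ᶠ_; suc-injective to fsuc-injective)
open import Data.Fin.Subset using (Subset; ∣_∣)
open import Data.Fin.Permutation using (Permutation; _⟨$⟩ʳ_; inverseʳ)
import Data.Fin.Permutation as Perm
open import Data.Vec using (Vec; []; _∷_; lookup; tabulate)
open import Data.Vec.Properties using (lookup∘tabulate; tabulate∘lookup; tabulate-cong)
open import Data.List using (length; filterᵇ)
import Data.List as List
open import Data.Maybe using (Maybe; just; nothing)
import Data.Maybe as Maybe
open import Data.Sum using (_⊎_; inj₁; inj₂; [_,_]′)
import Data.Sum as Sum
open import Data.Product using (Σ; _×_; _,_; proj₁; proj₂)
open import Data.Empty using (⊥-elim)
open import Function.Bundles using (Equivalence)
open import Function.Definitions using (Injective)
open import Relation.Nullary using (¬_; Dec; yes; no; ⌊_⌋)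
open import Relation.Nullary.Decidable using (¬?; _×-dec_; _→-dec_; map′; toWitness; ⌊⌋-map′)
open import Relation.Unary using (Decidable)
open import Relation.Binary.PropositionalEquality
open import Algebra.Properties.CommutativeMonoid.Sum +-0-commutativeMonoid
  using (sum; sum-cong-≗; ∑-distrib-+; ∑-comm; ∑-permute)

≡ᶠ-refl : ∀ {k} (a : Fin k) → (a ≡ᶠ a) ≡ true
≡ᶠ-refl a with a ≟ᶠ a
... | yes _ = refl
... | no a≢a = ⊥-elim (a≢a refl)

≡ᶠ⇒≡ : ∀ {k} {a b : Fin k} → (a ≡ᶠ b) ≡ true → a ≡ b
≡ᶠ⇒≡ {a = a} {b} e with a ≟ᶠ b
... | yes a≡b = a≡b

≢⇒≡ᶠ-false : ∀ {k} {a b : Fin k} → a ≢ b → (a ≡ᶠ b) ≡ false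
≢⇒≡ᶠ-false {a = a} {b} a≢b with a ≟ᶠ b
... | yes a≡b = ⊥-elim (a≢b a≡b)
... | no _ = refl

≡ᶠ-suc : ∀ {k} (a b : Fin k) → (suc a ≡ᶠ suc b) ≡ (a ≡ᶠ b)
≡ᶠ-suc a b = ⌊⌋-map′ (cong suc) fsuc-injective (a ≟ᶠ b)

≡ᶠ-injective : ∀ {k n} (φ : Fin k → Fin n) → Injective _≡_ _≡_ φ →
  ∀ a b → (φ a ≡ᶠ φ b) ≡ (a ≡ᶠ b)
≡ᶠ-injective φ inj a b with a ≟ᶠ b
... | yes refl = ≡ᶠ-refl (φ a)
... | no a≢b = ≢⇒≡ᶠ-false (λ e → a≢b (inj e))

≡ᶠ-sym : ∀ {k} (a b : Fin k) → (a ≡ᶠ b) ≡ (b ≡ᶠ a)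
≡ᶠ-sym a b with a ≟ᶠ b
... | yes refl = sym (≡ᶠ-refl a)
... | no a≢b = sym (≢⇒≡ᶠ-false (λ e → a≢b (sym e)))

bit : Bool → ℕ
bit true = 1
bit false = 0

bit-∧ : ∀ b x → bit (b ∧ x) ≡ (if b then bit x else 0)
bit-∧ true x = refl
bit-∧ false x = refl

length-filter-tabulate : ∀ {n} {A : Set} (p : A → Bool) (f : Fin n → A) →
  length (filterᵇ p (List.tabulate f)) ≡ sum (λ i → bit (p (f i)))
length-filter-tabulate {zero} p f = refl
length-filter-tabulate {suc n} p f with p (f zero)
... | true = cong suc (length-filter-tabulate p (λ i → f (suc i)))
... | false = length-filter-tabulate p (λ i → f (suc i))

countᵛ≡sum : ∀ {n} (p : Fin n → Bool) → countᵛ p ≡ sum (λ i → bit (p i))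
countᵛ≡sum p = length-filter-tabulate p (λ i → i)

nbrsIn≡sum : ∀ {n} (G : Graph n) (S : Subset n) x →
  nbrsIn G S x ≡ sum (λ y → bit (G x y ∧ lookup S y))
nbrsIn≡sum G S x = countᵛ≡sum (λ y → G x y ∧ lookup S y)

∣∣≡sum : ∀ {n} (S : Subset n) → ∣ S ∣ ≡ sum (λ i → bit (lookup S i))
∣∣≡sum [] = refl
∣∣≡sum (true ∷ S) = cong suc (∣∣≡sum S)
∣∣≡sum (false ∷ S) = ∣∣≡sum S

sum-zero : ∀ {n} (f : Fin n → ℕ) → (∀ i → f i ≡ 0) → sum f ≡ 0
sum-zero {zero} f f≡0 = refl
sum-zero {suc n} f f≡0 rewrite f≡0 zero = sum-zero (λ i → f (suc i)) (λ i → f≡0 (suc i))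

sum≡0⇒ : ∀ {n} (f : Fin n → ℕ) → sum f ≡ 0 → ∀ i → f i ≡ 0
sum≡0⇒ {suc n} f s≡0 zero = m+n≡0⇒m≡0 (f zero) s≡0
sum≡0⇒ {suc n} f s≡0 (suc i) = sum≡0⇒ (λ j → f (suc j)) (m+n≡0⇒n≡0 (f zero) s≡0) i

sum-select : ∀ {n} (a : Fin n) (f : Fin n → ℕ) → sum (λ i → if a ≡ᶠ i then f i else 0) ≡ f a
sum-select {suc n} zero f = trans (cong (f zero +_) (sum-zero {n} (λ _ → 0) (λ _ → refl))) (+-identityʳ _)
sum-select {suc n} (suc a) f =
  trans (sum-cong-≗ (λ i → cong (λ b → if b then f (suc i) else 0) (≡ᶠ-suc a i)))
        (sum-select a (λ i → f (suc i)))

sum-point : ∀ {n} (a : Fin n) (g : Fin n → Bool) → sum (λ i → bit ((i ≡ᶠ a) ∧ g i)) ≡ bit (g a)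
sum-point a g = trans (sum-cong-≗ pointwise) (sum-select a (λ i → bit (g i)))
  where
  pointwise : ∀ i → bit ((i ≡ᶠ a) ∧ g i) ≡ (if a ≡ᶠ i then bit (g i) else 0)
  pointwise i rewrite ≡ᶠ-sym i a = bit-∧ (a ≡ᶠ i) (g i)

sum-↑ : ∀ {n m} (f : Fin (n + m) → ℕ) → sum f ≡ sum (λ i → f (i ↑ˡ m)) + sum (λ j → f (n ↑ʳ j))
sum-↑ {zero} f = refl
sum-↑ {suc n} {m} f rewrite sum-↑ {n} {m} (λ i → f (suc i)) = sym (+-assoc (f zero) _ _)

preimage : ∀ {k n} → (Fin k → Fin n) → Fin n → Maybe (Fin k)
preimage {zero} φ y = nothing
preimage {suc k} φ y =
  if φ zero ≡ᶠ y then just zero else Maybe.map suc (preimage (λ i → φ (suc i)) y)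

preimage-just : ∀ {k n} (φ : Fin k → Fin n) y i → preimage φ y ≡ just i → φ i ≡ y
preimage-just {suc k} φ y i e with φ zero ≡ᶠ y in eq
preimage-just {suc k} φ y zero refl | true = ≡ᶠ⇒≡ eq
... | false with preimage (λ j → φ (suc j)) y in eq′
preimage-just {suc k} φ y (suc i) refl | false | just .i = preimage-just (λ j → φ (suc j)) y i eq′

preimage-nothing : ∀ {k n} (φ : Fin k → Fin n) y → preimage φ y ≡ nothing → ∀ i → (φ i ≡ᶠ y) ≡ false
preimage-nothing {suc k} φ y e i with φ zero ≡ᶠ y in eq | preimage (λ j → φ (suc j)) y in eq′
preimage-nothing {suc k} φ y e zero | false | _ = eq
preimage-nothing {suc k} φ y e (suc i) | false | nothing = preimage-nothing (λ j → φ (suc j)) y eq′ i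

preimage-image : ∀ {k n} (φ : Fin k → Fin n) → Injective _≡_ _≡_ φ → ∀ i → preimage φ (φ i) ≡ just i
preimage-image φ inj i with preimage φ (φ i) in eq
... | just j = cong just (inj (preimage-just φ (φ i) j eq))
... | nothing with () ← trans (sym (≡ᶠ-refl (φ i))) (preimage-nothing φ (φ i) eq i)

Outside : ∀ {k n} → (Fin k → Fin n) → Fin n → Set
Outside φ x = preimage φ x ≡ nothing

outsideSum : ∀ {k n} → (Fin k → Fin n) → (Fin n → ℕ) → ℕ
outsideSum φ f = sum (λ x → Maybe.maybe′ (λ _ → 0) (f x) (preimage φ x))

outsideSum-cong : ∀ {k n} (φ : Fin k → Fin n) {f g : Fin n → ℕ} →
  (∀ x → Outside φ x → f x ≡ g x) → outsideSum φ f ≡ outsideSum φ g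
outsideSum-cong φ {f} {g} f≡g = sum-cong-≗ pointwise
  where
  pointwise : ∀ x → Maybe.maybe′ (λ _ → 0) (f x) (preimage φ x) ≡ Maybe.maybe′ (λ _ → 0) (g x) (preimage φ x)
  pointwise x with preimage φ x in eq
  ... | just _ = refl
  ... | nothing = f≡g x eq

outsideSum-zero : ∀ {k n} (φ : Fin k → Fin n) (f : Fin n → ℕ) →
  (∀ x → Outside φ x → f x ≡ 0) → outsideSum φ f ≡ 0
outsideSum-zero φ f f≡0 = trans (outsideSum-cong φ f≡0) (sum-zero _ zero-everywhere)
  where
  zero-everywhere : ∀ x → Maybe.maybe′ (λ _ → 0) 0 (preimage φ x) ≡ 0
  zero-everywhere x with preimage φ x
  ... | just _ = refl
  ... | nothing = refl

sum-image : ∀ {k n} (φ : Fin k → Fin n) → Injective _≡_ _≡_ φ → (f : Fin n → ℕ) →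
  sum f ≡ outsideSum φ f + sum (λ i → f (φ i))
sum-image {k} {n} φ inj f = begin
  sum f                                                         ≡⟨ sum-cong-≗ split ⟩
  sum (λ x → outside x + sum (λ i → hit i x))                   ≡⟨ ∑-distrib-+ outside _ ⟩
  outsideSum φ f + sum (λ x → sum (λ i → hit i x))              ≡⟨ cong (outsideSum φ f +_) (∑-comm (λ x i → hit i x)) ⟩
  outsideSum φ f + sum (λ i → sum (λ x → hit i x))              ≡⟨ cong (outsideSum φ f +_) (sum-cong-≗ (λ i → sum-select (φ i) f)) ⟩
  outsideSum φ f + sum (λ i → f (φ i))                          ∎
  where
  open ≡-Reasoning
  outside : Fin n → ℕ
  outside x = Maybe.maybe′ (λ _ → 0) (f x) (preimage φ x)
  hit : Fin k → Fin n → ℕ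
  hit i x = if φ i ≡ᶠ x then f x else 0
  -- each x is either outside the image or hit by exactly one i
  split : ∀ x → f x ≡ outside x + sum (λ i → hit i x)
  split x with preimage φ x in eq
  ... | nothing = sym (trans (cong (f x +_) (sum-zero _ (λ i → cong (λ b → if b then f x else 0)
                                                                  (preimage-nothing φ x eq i))))
                            (+-identityʳ (f x)))
  ... | just j with refl ← preimage-just φ x j eq =
    sym (trans (sum-cong-≗ (λ i → cong (λ b → if b then f (φ j) else 0) (trans (≡ᶠ-sym (φ i) (φ j)) (≡ᶠ-injective φ inj j i))))
               (sum-select j (λ _ → f (φ j))))

outsideSum≡0⇒ : ∀ {k n} (φ : Fin k → Fin n) (f : Fin n → ℕ) → outsideSum φ f ≡ 0 → ∀ x → Outside φ x → f x ≡ 0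
outsideSum≡0⇒ φ f s≡0 x ox with sum≡0⇒ _ s≡0 x
... | fx≡0 rewrite ox = fx≡0

allFin? : ∀ {p} {P : Fin p → Set} → Decidable P → Dec (∀ i → P i)
allFin? {zero} P? = yes λ ()
allFin? {suc p} P? = map′
  (λ { (P0 , Ps) zero → P0 ; (P0 , Ps) (suc i) → Ps i })
  (λ ∀P → ∀P zero , λ i → ∀P (suc i))
  (P? zero ×-dec allFin? (λ i → P? (suc i)))

allSubsets? : ∀ {n} {P : Subset n → Set} → Decidable P → Dec (∀ S → P S)
allSubsets? {zero} P? = map′ (λ { P[] [] → P[] }) (λ ∀P → ∀P []) (P? [])
allSubsets? {suc n} P? = map′
  (λ { (Pin , Pout) (true ∷ S) → Pin S ; (Pin , Pout) (false ∷ S) → Pout S })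
  (λ ∀P → (λ S → ∀P (true ∷ S)) , (λ S → ∀P (false ∷ S)))
  (allSubsets? (λ S → P? (true ∷ S)) ×-dec allSubsets? (λ S → P? (false ∷ S)))

-- Decides A → B, consulting the (typically cheap) conclusion first.
_⇒?_ : ∀ {A B : Set} → Dec A → Dec B → Dec (A → B)
a? ⇒? yes b = yes (λ _ → b)
a? ⇒? no ¬b = map′ (λ ¬a a → ⊥-elim (¬a a)) (λ A→B a → ¬b (A→B a)) (¬? a?)

witness : ∀ {A : Set} {a? : Dec A} → ⌊ a? ⌋ ≡ true → A
witness {a? = a?} ok = toWitness {a? = a?} (Equivalence.from T-≡ ok)

_∈ˢ?_ : ∀ {n} (x : Fin n) (S : Subset n) → Dec (x ∈ˢ S)
x ∈ˢ? S = lookup S x ≟ᵇ true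

-- An untrusted search proposing an ok subset whose size is extremal with respect to `better`.
optimum : ∀ {n} → (ℕ → ℕ → Bool) → (Subset n → Bool) → Maybe (Subset n)
optimum {zero} better ok = if ok [] then just [] else nothing
optimum {suc n} better ok =
  choose (Maybe.map (true ∷_) (optimum better (λ S → ok (true ∷ S))))
         (Maybe.map (false ∷_) (optimum better (λ S → ok (false ∷ S))))
  where
  choose : Maybe (Subset (suc n)) → Maybe (Subset (suc n)) → Maybe (Subset (suc n))
  choose nothing m = m
  choose (just S) nothing = just S
  choose (just S) (just S′) = if better ∣ S′ ∣ ∣ S ∣ then just S′ else just S

-- Certificates for statements  ∀ S → P S → ∃ S′ → Q S′ × R S S′  over subsets:
-- a single S′ serving every S.
Uniform : ∀ {p q} → (Subset p → Set) → (Subset q → Set) → (Subset p → Subset q → Set) → Subset q → Set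
Uniform P Q R S′ = Q S′ × (∀ S → P S → R S S′)

module Certificate {p q} {P : Subset p → Set} {Q : Subset q → Set} {R : Subset p → Subset q → Set}
                   (P? : Decidable P) (Q? : Decidable Q) (R? : ∀ S S′ → Dec (R S S′)) where

  uniform? : Decidable (Uniform P Q R)
  uniform? S′ = Q? S′ ×-dec allSubsets? (λ S → P? S ⇒? R? S S′)

  -- a proposed witness is checked for uniformity; no proposal means no S satisfies P
  certified : Maybe (Subset q) → Bool
  certified (just S′) = ⌊ uniform? S′ ⌋
  certified nothing = ⌊ allSubsets? (λ S → ¬? (P? S)) ⌋

  proposal : (ℕ → ℕ → Bool) → Maybe (Subset q)
  proposal better = optimum better (λ S′ → ⌊ Q? S′ ⌋)

  certified-sound : ∀ m → T (certified m) → ∀ S → P S → Σ (Subset q) λ S′ → Q S′ × R S S′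
  certified-sound (just S′) ok S PS with toWitness {a? = uniform? S′} ok
  ... | QS′ , all = S′ , QS′ , all S PS
  certified-sound nothing ok S PS = ⊥-elim (toWitness {a? = allSubsets? (λ S → ¬? (P? S))} ok S PS)

-- Local 2-domination and 2-independence of a port graph L with port w, when the port has
-- c further neighbours in the set outside L.

portIn : ∀ {p} → Fin p → ℕ → Fin p → ℕ
portIn w c i = if i ≡ᶠ w then c else 0

PortDominating : ∀ {p} → Graph p → Fin p → ℕ → Subset p → Set
PortDominating L w c S = ∀ i → ¬ (i ∈ˢ S) → 2 ≤ nbrsIn L S i + portIn w c i

PortIndependent : ∀ {p} → Graph p → Fin p → ℕ → Subset p → Set
PortIndependent L w c S = ∀ i → i ∈ˢ S → nbrsIn L S i + portIn w c i ≤ 1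

portDominating? : ∀ {p} (L : Graph p) w c → Decidable (PortDominating L w c)
portDominating? L w c S = allFin? (λ i → ¬? (i ∈ˢ? S) →-dec (2 ≤? nbrsIn L S i + portIn w c i))

portIndependent? : ∀ {p} (L : Graph p) w c → Decidable (PortIndependent L w c)
portIndependent? L w c S = allFin? (λ i → (i ∈ˢ? S) →-dec (nbrsIn L S i + portIn w c i ≤? 1))

-- Replacing a port graph (L₁, w₁) by (L₂, w₂): every locally 2-dominating set of L₁ has a
-- counterpart for L₂, costing d₂ − d₁ more, that keeps the port whenever the original did
-- (so the outside stays dominated) ...
DomExchange : ∀ {p₁ p₂} → Graph p₁ → Fin p₁ → Graph p₂ → Fin p₂ → ℕ → ℕ → Set
DomExchange {p₁} {p₂} L₁ w₁ L₂ w₂ d₁ d₂ = ∀ c → c ≤ 2 → (S : Subset p₁) → PortDominating L₁ w₁ c S →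
  Σ (Subset p₂) λ S′ → PortDominating L₂ w₂ c S′ × (w₁ ∈ˢ S → w₂ ∈ˢ S′) × ∣ S′ ∣ + d₁ ≤ ∣ S ∣ + d₂

-- ... and every locally 2-independent set of L₁ has a counterpart for L₂, gaining d₂ − d₁,
-- that uses the port only if the original did (so the outside stays independent).
IndExchange : ∀ {p₁ p₂} → Graph p₁ → Fin p₁ → Graph p₂ → Fin p₂ → ℕ → ℕ → Set
IndExchange {p₁} {p₂} L₁ w₁ L₂ w₂ d₁ d₂ = ∀ c → c ≤ 2 → (S : Subset p₁) → PortIndependent L₁ w₁ c S →
  Σ (Subset p₂) λ S′ → PortIndependent L₂ w₂ c S′ × (w₂ ∈ˢ S′ → w₁ ∈ˢ S) × ∣ S ∣ + d₂ ≤ ∣ S′ ∣ + d₁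

-- (L₁, w₁) and (L₂, w₂) are exchangeable at cost a: in any host graph, replacing the port
-- graph L₁ by L₂ raises both γ₂ and α₂ by exactly a.
record Exchangeable {p₁ p₂} (L₁ : Graph p₁) (w₁ : Fin p₁) (L₂ : Graph p₂) (w₂ : Fin p₂) (a : ℕ) : Set where
  field
    dom-up   : DomExchange L₁ w₁ L₂ w₂ 0 a
    dom-down : DomExchange L₂ w₂ L₁ w₁ a 0
    ind-up   : IndExchange L₁ w₁ L₂ w₂ 0 a
    ind-down : IndExchange L₂ w₂ L₁ w₁ a 0

allPorts : (ℕ → Bool → Bool) → Bool
allPorts f = (f 0 true ∧ f 0 false) ∧ (f 1 true ∧ f 1 false) ∧ (f 2 true ∧ f 2 false)

allPorts-sound : ∀ f → T (allPorts f) → ∀ c → c ≤ 2 → ∀ b → T (f c b)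
allPorts-sound f ok c c≤2 b = pick c c≤2 b (Equivalence.to T-∧ ok)
  where
  both : ∀ c b → T (f c true ∧ f c false) → T (f c b)
  both c true ok′ = proj₁ (Equivalence.to T-∧ ok′)
  both c false ok′ = proj₂ (Equivalence.to (T-∧ {f c true}) ok′)
  pick : ∀ c → c ≤ 2 → ∀ b → T (f 0 true ∧ f 0 false) × T ((f 1 true ∧ f 1 false) ∧ (f 2 true ∧ f 2 false)) → T (f c b)
  pick 0 _ b (ok₀ , _) = both 0 b ok₀
  pick 1 _ b (_ , ok₁₂) = both 1 b (proj₁ (Equivalence.to T-∧ ok₁₂))
  pick 2 _ b (_ , ok₁₂) = both 2 b (proj₂ (Equivalence.to (T-∧ {f 1 true ∧ f 1 false}) ok₁₂))
  pick (suc (suc (suc _))) (s≤s (s≤s ())) b _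

module ExchangeCheck {p₁ p₂} (L₁ : Graph p₁) (w₁ : Fin p₁) (L₂ : Graph p₂) (w₂ : Fin p₂) (d₁ d₂ : ℕ) where

  module Dom (c : ℕ) (b : Bool) = Certificate
    {P = λ S → lookup S w₁ ≡ b × PortDominating L₁ w₁ c S}
    {Q = λ S′ → (b ≡ true → w₂ ∈ˢ S′) × PortDominating L₂ w₂ c S′}
    {R = λ S S′ → ∣ S′ ∣ + d₁ ≤ ∣ S ∣ + d₂}
    (λ S → (lookup S w₁ ≟ᵇ b) ×-dec portDominating? L₁ w₁ c S)
    (λ S′ → ((b ≟ᵇ true) →-dec (w₂ ∈ˢ? S′)) ×-dec portDominating? L₂ w₂ c S′)
    (λ S S′ → ∣ S′ ∣ + d₁ ≤? ∣ S ∣ + d₂)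

  module Ind (c : ℕ) (b : Bool) = Certificate
    {P = λ S → lookup S w₁ ≡ b × PortIndependent L₁ w₁ c S}
    {Q = λ S′ → (w₂ ∈ˢ S′ → b ≡ true) × PortIndependent L₂ w₂ c S′}
    {R = λ S S′ → ∣ S ∣ + d₂ ≤ ∣ S′ ∣ + d₁}
    (λ S → (lookup S w₁ ≟ᵇ b) ×-dec portIndependent? L₁ w₁ c S)
    (λ S′ → ((w₂ ∈ˢ? S′) →-dec (b ≟ᵇ true)) ×-dec portIndependent? L₂ w₂ c S′)
    (λ S S′ → ∣ S ∣ + d₂ ≤? ∣ S′ ∣ + d₁)

  -- dominating counterparts are sought small, independent ones large
  domCase indCase : ℕ → Bool → Bool
  domCase c b = Dom.certified c b (Dom.proposal c b _<ᵇ_)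
  indCase c b = Ind.certified c b (Ind.proposal c b (λ x y → y <ᵇ x))

  domCheck indCheck : Bool
  domCheck = allPorts domCase
  indCheck = allPorts indCase

  domCheck-sound : T domCheck → DomExchange L₁ w₁ L₂ w₂ d₁ d₂
  domCheck-sound ok c c≤2 S dom
    with Dom.certified-sound c (lookup S w₁) (Dom.proposal c (lookup S w₁) _<ᵇ_) (allPorts-sound domCase ok c c≤2 (lookup S w₁)) S (refl , dom)
  ... | S′ , (keep , dom′) , cheaper = S′ , dom′ , keep , cheaper

  indCheck-sound : T indCheck → IndExchange L₁ w₁ L₂ w₂ d₁ d₂
  indCheck-sound ok c c≤2 S ind
    with Ind.certified-sound c (lookup S w₁) (Ind.proposal c (lookup S w₁) (λ x y → y <ᵇ x)) (allPorts-sound indCase ok c c≤2 (lookup S w₁)) S (refl , ind)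
  ... | S′ , (keep , ind′) , larger = S′ , ind′ , keep , larger

exchangeable? : ∀ {p₁ p₂} → Graph p₁ → Fin p₁ → Graph p₂ → Fin p₂ → ℕ → Bool
exchangeable? L₁ w₁ L₂ w₂ a =
  (Up.domCheck ∧ Down.domCheck) ∧ (Up.indCheck ∧ Down.indCheck)
  where
  module Up = ExchangeCheck L₁ w₁ L₂ w₂ 0 a
  module Down = ExchangeCheck L₂ w₂ L₁ w₁ a 0

exchangeable-sound : ∀ {p₁ p₂} (L₁ : Graph p₁) w₁ (L₂ : Graph p₂) w₂ a →
  exchangeable? L₁ w₁ L₂ w₂ a ≡ true → Exchangeable L₁ w₁ L₂ w₂ a
exchangeable-sound L₁ w₁ L₂ w₂ a ok with Equivalence.to T-∧ (Equivalence.from T-≡ ok)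
... | doms , inds with Equivalence.to T-∧ doms | Equivalence.to T-∧ inds
... | dom-up , dom-down | ind-up , ind-down = record
  { dom-up = Up.domCheck-sound dom-up ; dom-down = Down.domCheck-sound dom-down
  ; ind-up = Up.indCheck-sound ind-up ; ind-down = Down.indCheck-sound ind-down }
  where
  module Up = ExchangeCheck L₁ w₁ L₂ w₂ 0 a
  module Down = ExchangeCheck L₂ w₂ L₁ w₁ a 0

-- G is glued from a context and a port graph: its vertices are those of the context graph Go
-- lying outside the image of φ, together with the vertices of a port graph `local`, and the
-- only edges between the two parts join the port to the context vertices x with att x.
record Gluing {N} (G : Graph N) {n k} (φ : Fin k → Fin n) (Go : Graph n) (att : Fin n → Bool) (p : ℕ) : Set where
  field
    out      : Fin n → Fin N
    loc      : Fin p → Fin N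
    local    : Graph p
    port     : Fin p
    side     : Fin N → Fin n ⊎ Fin p
    side-out : ∀ y x → side y ≡ inj₁ x → y ≡ out x × Outside φ x
    side-loc : ∀ y i → side y ≡ inj₂ i → y ≡ loc i
    side∘out : ∀ x → Outside φ x → side (out x) ≡ inj₁ x
    side∘loc : ∀ i → side (loc i) ≡ inj₂ i
    sum-split : ∀ f → sum f ≡ outsideSum φ (λ x → f (out x)) + sum (λ i → f (loc i))
    out-out  : ∀ x y → Outside φ x → Outside φ y → G (out x) (out y) ≡ Go x y
    out-loc  : ∀ x i → Outside φ x → G (out x) (loc i) ≡ att x ∧ (i ≡ᶠ port)
    loc-out  : ∀ i x → Outside φ x → G (loc i) (out x) ≡ att x ∧ (i ≡ᶠ port)
    loc-loc  : ∀ i j → G (loc i) (loc j) ≡ local i j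

relocal : ∀ {N} {G : Graph N} {n k} {φ : Fin k → Fin n} {Go att p} (D : Gluing G φ Go att p) (L : Graph p) →
  (∀ i j → Gluing.local D i j ≡ L i j) → Gluing G φ Go att p
relocal D L same = record D { local = L ; loc-loc = λ i j → trans (Gluing.loc-loc D i j) (same i j) }

outsideCount : ∀ {n k} → (Fin k → Fin n) → (Fin n → Bool) → ℕ
outsideCount φ o = outsideSum φ (λ x → bit (o x))

portLoad : ∀ {n k} → (Fin k → Fin n) → (Fin n → Bool) → (Fin n → Bool) → ℕ
portLoad φ att o = outsideSum φ (λ x → bit (att x ∧ o x))

outsideDegree : ∀ {n k} → (Fin k → Fin n) → Graph n → (Fin n → Bool) → Fin n → ℕ
outsideDegree φ Go o x = outsideSum φ (λ y → bit (Go x y ∧ o y))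

module Glued {N} {G : Graph N} {n k} {φ : Fin k → Fin n} {Go att p} (D : Gluing G φ Go att p) where
  open Gluing D

  outer : Subset N → Fin n → Bool
  outer S x = lookup S (out x)

  inner : Subset N → Subset p
  inner S = tabulate (λ i → lookup S (loc i))

  lookup-inner : ∀ S i → lookup (inner S) i ≡ lookup S (loc i)
  lookup-inner S i = lookup∘tabulate _ i

  glue : (Fin n → Bool) → Subset p → Subset N
  glue o t = tabulate (λ y → [ o , lookup t ]′ (side y))

  outer-glue : ∀ o t x → Outside φ x → outer (glue o t) x ≡ o x
  outer-glue o t x ox rewrite lookup∘tabulate (λ y → [ o , lookup t ]′ (side y)) (out x) | side∘out x ox = refl

  inner-glue : ∀ o t → inner (glue o t) ≡ t
  inner-glue o t = trans (tabulate-cong pointwise) (tabulate∘lookup t)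
    where
    pointwise : ∀ i → lookup (glue o t) (loc i) ≡ lookup t i
    pointwise i rewrite lookup∘tabulate (λ y → [ o , lookup t ]′ (side y)) (loc i) | side∘loc i = refl

  card : ∀ S → ∣ S ∣ ≡ outsideCount φ (outer S) + ∣ inner S ∣
  card S = begin
    ∣ S ∣                                                                  ≡⟨ ∣∣≡sum S ⟩
    sum (λ y → bit (lookup S y))                                           ≡⟨ sum-split _ ⟩
    outsideCount φ (outer S) + sum (λ i → bit (lookup S (loc i)))         ≡⟨ cong (outsideCount φ (outer S) +_)
                                                                              (sum-cong-≗ (λ i → cong bit (sym (lookup-inner S i)))) ⟩
    outsideCount φ (outer S) + sum (λ i → bit (lookup (inner S) i))       ≡⟨ cong (outsideCount φ (outer S) +_) (sym (∣∣≡sum (inner S))) ⟩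
    outsideCount φ (outer S) + ∣ inner S ∣                                 ∎
    where open ≡-Reasoning

  nbrs-loc : ∀ S i → nbrsIn G S (loc i) ≡ nbrsIn local (inner S) i + portIn port (portLoad φ att (outer S)) i
  nbrs-loc S i = begin
    nbrsIn G S (loc i)                                                     ≡⟨ nbrsIn≡sum G S (loc i) ⟩
    sum (λ y → bit (G (loc i) y ∧ lookup S y))                             ≡⟨ sum-split _ ⟩
    fromContext + sum (λ j → bit (G (loc i) (loc j) ∧ lookup S (loc j)))   ≡⟨ cong₂ _+_ context (sum-cong-≗ inPort) ⟩
    portIn port (portLoad φ att (outer S)) i + sum (λ j → bit (local i j ∧ lookup (inner S) j))
                                                                           ≡⟨ +-comm (portIn port (portLoad φ att (outer S)) i) _ ⟩
    sum (λ j → bit (local i j ∧ lookup (inner S) j)) + portIn port (portLoad φ att (outer S)) i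
                                                                           ≡⟨ cong (_+ portIn port (portLoad φ att (outer S)) i) (sym (nbrsIn≡sum local (inner S) i)) ⟩
    nbrsIn local (inner S) i + portIn port (portLoad φ att (outer S)) i   ∎
    where
    open ≡-Reasoning
    fromContext : ℕ
    fromContext = outsideSum φ (λ x → bit (G (loc i) (out x) ∧ lookup S (out x)))
    context : fromContext ≡ portIn port (portLoad φ att (outer S)) i
    context with i ≡ᶠ port in i≟port
    ... | true = outsideSum-cong φ (λ x ox → cong (λ e → bit (e ∧ outer S x))
                   (trans (loc-out i x ox) (trans (cong (att x ∧_) i≟port) (∧-identityʳ (att x)))))
    ... | false = outsideSum-zero φ _ (λ x ox → cong (λ e → bit (e ∧ outer S x))
                   (trans (loc-out i x ox) (trans (cong (att x ∧_) i≟port) (∧-zeroʳ (att x)))))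
    inPort : ∀ j → bit (G (loc i) (loc j) ∧ lookup S (loc j)) ≡ bit (local i j ∧ lookup (inner S) j)
    inPort j = cong₂ (λ e s → bit (e ∧ s)) (loc-loc i j) (sym (lookup-inner S j))

  nbrs-out : ∀ S x → Outside φ x →
    nbrsIn G S (out x) ≡ outsideDegree φ Go (outer S) x + bit (att x ∧ lookup (inner S) port)
  nbrs-out S x ox = begin
    nbrsIn G S (out x)                                                     ≡⟨ nbrsIn≡sum G S (out x) ⟩
    sum (λ y → bit (G (out x) y ∧ lookup S y))                             ≡⟨ sum-split _ ⟩
    outsideSum φ (λ y → bit (G (out x) (out y) ∧ outer S y)) + sum (λ i → bit (G (out x) (loc i) ∧ lookup S (loc i)))
                                                                           ≡⟨ cong₂ _+_ context (sum-cong-≗ toPort) ⟩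
    outsideDegree φ Go (outer S) x + sum (λ i → bit ((i ≡ᶠ port) ∧ (att x ∧ lookup (inner S) i)))
                                                                           ≡⟨ cong (outsideDegree φ Go (outer S) x +_)
                                                                                (sum-point port (λ i → att x ∧ lookup (inner S) i)) ⟩
    outsideDegree φ Go (outer S) x + bit (att x ∧ lookup (inner S) port)  ∎
    where
    open ≡-Reasoning
    context : outsideSum φ (λ y → bit (G (out x) (out y) ∧ outer S y)) ≡ outsideDegree φ Go (outer S) x
    context = outsideSum-cong φ (λ y oy → cong (λ e → bit (e ∧ outer S y)) (out-out x y ox oy))
    toPort : ∀ i → bit (G (out x) (loc i) ∧ lookup S (loc i)) ≡ bit ((i ≡ᶠ port) ∧ (att x ∧ lookup (inner S) i))
    toPort i rewrite out-loc x i ox | lookup-inner S i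
                   | ∧-assoc (att x) (i ≡ᶠ port) (lookup S (loc i)) | ∧-comm (att x) ((i ≡ᶠ port) ∧ lookup S (loc i))
                   | ∧-assoc (i ≡ᶠ port) (lookup S (loc i)) (att x) | ∧-comm (lookup S (loc i)) (att x) = refl

-- An incoming count above 2 at the port acts like 2 for both thresholds.
portIn-cap-≤ : ∀ {p} (w i : Fin p) R → portIn w (R ⊓ 2) i ≤ portIn w R i
portIn-cap-≤ w i R with i ≡ᶠ w
... | true = m⊓n≤m R 2
... | false = ≤-refl

portIn-cap-dominates : ∀ {p} (w i : Fin p) a R → 2 ≤ a + portIn w R i → 2 ≤ a + portIn w (R ⊓ 2) i
portIn-cap-dominates w i a R h with i ≡ᶠ w | ≤-total R 2
... | false | _ = h
... | true | inj₁ R≤2 rewrite m≤n⇒m⊓n≡m R≤2 = h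
... | true | inj₂ 2≤R rewrite m≥n⇒m⊓n≡n 2≤R = m≤n+m 2 a

portIn-cap-independent : ∀ {p} (w i : Fin p) a R → a + portIn w (R ⊓ 2) i ≤ 1 → a + portIn w R i ≤ 1
portIn-cap-independent w i a R h with i ≡ᶠ w | ≤-total R 2
... | false | _ = h
... | true | inj₁ R≤2 rewrite m≤n⇒m⊓n≡m R≤2 = h
... | true | inj₂ 2≤R rewrite m≥n⇒m⊓n≡n 2≤R = ⊥-elim (2≰1 (≤-trans (m≤n+m 2 a) h))
  where
  2≰1 : ¬ 2 ≤ 1
  2≰1 (s≤s ())

bit-∧-mono : ∀ c {a b} → (a ≡ true → b ≡ true) → bit (c ∧ a) ≤ bit (c ∧ b)
bit-∧-mono false a⇒b = z≤n
bit-∧-mono true {false} a⇒b = z≤n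
bit-∧-mono true {true} a⇒b rewrite a⇒b refl = ≤-refl

-- Two gluings of the same context: sets of the first graph are carried to the second one by
-- keeping their context part and exchanging their port-graph part.
module Transfer {N₁ N₂} {G₁ : Graph N₁} {G₂ : Graph N₂} {n k} {φ : Fin k → Fin n} {Go att p₁ p₂}
                (D₁ : Gluing G₁ φ Go att p₁) (D₂ : Gluing G₂ φ Go att p₂) where
  module D₁ = Gluing D₁
  module D₂ = Gluing D₂
  module Glued₁ = Glued D₁
  module Glued₂ = Glued D₂
  open Glued₁ using (outer; inner)

  module Swap (S : Subset N₁) (t : Subset p₂) where
    S₂ : Subset N₂
    S₂ = Glued₂.glue (outer S) t

    outer-S₂ : ∀ x → Outside φ x → Glued₂.outer S₂ x ≡ outer S x
    outer-S₂ = Glued₂.outer-glue (outer S) t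

    member-loc : ∀ i → lookup S₂ (D₂.loc i) ≡ lookup t i
    member-loc i = trans (sym (Glued₂.lookup-inner S₂ i)) (cong (λ u → lookup u i) (Glued₂.inner-glue (outer S) t))

    card-S₂ : ∣ S₂ ∣ ≡ outsideCount φ (outer S) + ∣ t ∣
    card-S₂ = trans (Glued₂.card S₂)
      (cong₂ _+_ (outsideSum-cong φ (λ x ox → cong bit (outer-S₂ x ox))) (cong ∣_∣ (Glued₂.inner-glue (outer S) t)))

    nbrs-loc : ∀ i → nbrsIn G₂ S₂ (D₂.loc i) ≡ nbrsIn D₂.local t i + portIn D₂.port (portLoad φ att (outer S)) i
    nbrs-loc i = trans (Glued₂.nbrs-loc S₂ i) (cong₂ (λ u R → nbrsIn D₂.local u i + portIn D₂.port R i)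
      (Glued₂.inner-glue (outer S) t) (outsideSum-cong φ (λ x ox → cong (λ s → bit (att x ∧ s)) (outer-S₂ x ox))))

    nbrs-out : ∀ x → Outside φ x → nbrsIn G₂ S₂ (D₂.out x) ≡ outsideDegree φ Go (outer S) x + bit (att x ∧ lookup t D₂.port)
    nbrs-out x ox = trans (Glued₂.nbrs-out S₂ x ox) (cong₂ (λ d u → d + bit (att x ∧ lookup u D₂.port))
      (outsideSum-cong φ (λ y oy → cong (λ s → bit (Go x y ∧ s)) (outer-S₂ y oy))) (Glued₂.inner-glue (outer S) t))

  transferDom : ∀ {d₁ d₂} → DomExchange D₁.local D₁.port D₂.local D₂.port d₁ d₂ →
    ∀ S → TwoDominating G₁ S → Σ (Subset N₂) λ S₂ → TwoDominating G₂ S₂ × ∣ S₂ ∣ + d₁ ≤ ∣ S ∣ + d₂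
  transferDom {d₁} {d₂} ex S dom = S₂ , dom₂ , cheaper
    where
    R : ℕ
    R = portLoad φ att (outer S)
    localDom : PortDominating D₁.local D₁.port (R ⊓ 2) (inner S)
    localDom i i∉S = portIn-cap-dominates D₁.port i _ R
      (subst (2 ≤_) (Glued₁.nbrs-loc S i) (dom (D₁.loc i) (λ i∈S → i∉S (trans (Glued₁.lookup-inner S i) i∈S))))
    exchanged : Σ (Subset p₂) λ t → PortDominating D₂.local D₂.port (R ⊓ 2) t ×
      (D₁.port ∈ˢ inner S → D₂.port ∈ˢ t) × ∣ t ∣ + d₁ ≤ ∣ inner S ∣ + d₂
    exchanged = ex (R ⊓ 2) (m⊓n≤n R 2) (inner S) localDom
    t : Subset p₂
    t = proj₁ exchanged
    open Swap S t
    dom₂ : TwoDominating G₂ S₂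
    dom₂ y y∉S₂ with D₂.side y in eq
    ... | inj₁ x with D₂.side-out y x eq
    ...   | refl , ox = begin
      2                                                                ≤⟨ dom (D₁.out x) (λ x∈S → y∉S₂ (trans (outer-S₂ x ox) x∈S)) ⟩
      nbrsIn G₁ S (D₁.out x)                                           ≡⟨ Glued₁.nbrs-out S x ox ⟩
      outsideDegree φ Go (outer S) x + bit (att x ∧ lookup (inner S) D₁.port)
                                                                       ≤⟨ +-monoʳ-≤ _ (bit-∧-mono (att x) (proj₁ (proj₂ (proj₂ exchanged)))) ⟩
      outsideDegree φ Go (outer S) x + bit (att x ∧ lookup t D₂.port)  ≡⟨ nbrs-out x ox ⟨
      nbrsIn G₂ S₂ (D₂.out x)                                          ∎
      where open ≤-Reasoning
    dom₂ y y∉S₂ | inj₂ i with D₂.side-loc y i eq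
    ...   | refl = begin
      2                                                                ≤⟨ proj₁ (proj₂ exchanged) i (λ i∈t → y∉S₂ (trans (member-loc i) i∈t)) ⟩
      nbrsIn D₂.local t i + portIn D₂.port (R ⊓ 2) i                   ≤⟨ +-monoʳ-≤ _ (portIn-cap-≤ D₂.port i R) ⟩
      nbrsIn D₂.local t i + portIn D₂.port R i                         ≡⟨ nbrs-loc i ⟨
      nbrsIn G₂ S₂ (D₂.loc i)                                          ∎
      where open ≤-Reasoning
    cheaper : ∣ S₂ ∣ + d₁ ≤ ∣ S ∣ + d₂
    cheaper rewrite card-S₂ | Glued₁.card S | +-assoc (outsideCount φ (outer S)) ∣ t ∣ d₁
               | +-assoc (outsideCount φ (outer S)) ∣ inner S ∣ d₂ = +-monoʳ-≤ (outsideCount φ (outer S)) (proj₂ (proj₂ (proj₂ exchanged)))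

  transferInd : ∀ {d₁ d₂} → IndExchange D₁.local D₁.port D₂.local D₂.port d₁ d₂ →
    ∀ S → TwoIndependent G₁ S → Σ (Subset N₂) λ S₂ → TwoIndependent G₂ S₂ × ∣ S ∣ + d₂ ≤ ∣ S₂ ∣ + d₁
  transferInd {d₁} {d₂} ex S ind = S₂ , ind₂ , larger
    where
    R : ℕ
    R = portLoad φ att (outer S)
    localInd : PortIndependent D₁.local D₁.port (R ⊓ 2) (inner S)
    localInd i i∈S = ≤-trans (+-monoʳ-≤ _ (portIn-cap-≤ D₁.port i R))
      (subst (_≤ 1) (Glued₁.nbrs-loc S i) (ind (D₁.loc i) (trans (sym (Glued₁.lookup-inner S i)) i∈S)))
    exchanged : Σ (Subset p₂) λ t → PortIndependent D₂.local D₂.port (R ⊓ 2) t ×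
      (D₂.port ∈ˢ t → D₁.port ∈ˢ inner S) × ∣ inner S ∣ + d₂ ≤ ∣ t ∣ + d₁
    exchanged = ex (R ⊓ 2) (m⊓n≤n R 2) (inner S) localInd
    t : Subset p₂
    t = proj₁ exchanged
    open Swap S t
    ind₂ : TwoIndependent G₂ S₂
    ind₂ y y∈S₂ with D₂.side y in eq
    ... | inj₁ x with D₂.side-out y x eq
    ...   | refl , ox = begin
      nbrsIn G₂ S₂ (D₂.out x)                                          ≡⟨ nbrs-out x ox ⟩
      outsideDegree φ Go (outer S) x + bit (att x ∧ lookup t D₂.port)  ≤⟨ +-monoʳ-≤ _ (bit-∧-mono (att x) (proj₁ (proj₂ (proj₂ exchanged)))) ⟩
      outsideDegree φ Go (outer S) x + bit (att x ∧ lookup (inner S) D₁.port)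
                                                                       ≡⟨ Glued₁.nbrs-out S x ox ⟨
      nbrsIn G₁ S (D₁.out x)                                           ≤⟨ ind (D₁.out x) (trans (sym (outer-S₂ x ox)) y∈S₂) ⟩
      1                                                                ∎
      where open ≤-Reasoning
    ind₂ y y∈S₂ | inj₂ i with D₂.side-loc y i eq
    ...   | refl = subst (_≤ 1) (sym (nbrs-loc i))
      (portIn-cap-independent D₂.port i _ R (proj₁ (proj₂ exchanged) i (trans (sym (member-loc i)) y∈S₂)))
    larger : ∣ S ∣ + d₂ ≤ ∣ S₂ ∣ + d₁
    larger rewrite card-S₂ | Glued₁.card S | +-assoc (outsideCount φ (outer S)) ∣ t ∣ d₁
                 | +-assoc (outsideCount φ (outer S)) ∣ inner S ∣ d₂ = +-monoʳ-≤ (outsideCount φ (outer S)) (proj₂ (proj₂ (proj₂ exchanged)))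

γ₂≡α₂ : ∀ {n} → Graph n → Set
γ₂≡α₂ G = Σ ℕ λ k → IsGamma2 G k × IsAlpha2 G k

module Exchange {N₁ N₂} {G₁ : Graph N₁} {G₂ : Graph N₂} {n k} {φ : Fin k → Fin n} {Go att p₁ p₂}
                (D₁ : Gluing G₁ φ Go att p₁) (D₂ : Gluing G₂ φ Go att p₂) where
  open Gluing D₁ using () renaming (local to L₁; port to w₁)
  open Gluing D₂ using () renaming (local to L₂; port to w₂)
  module Forth = Transfer D₁ D₂
  module Back = Transfer D₂ D₁

  gamma-shift : ∀ {a γ} → DomExchange L₁ w₁ L₂ w₂ 0 a → DomExchange L₂ w₂ L₁ w₁ a 0 →
    IsGamma2 G₁ γ → IsGamma2 G₂ (γ + a)
  gamma-shift {a} {γ} forth back ((S , dom , ∣S∣≡γ) , minimal) =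
    (S₂ , dom₂ , ≤-antisym upper (lower S₂ dom₂)) , lower
    where
    S₂ : Subset N₂
    S₂ = proj₁ (Forth.transferDom forth S dom)
    dom₂ : TwoDominating G₂ S₂
    dom₂ = proj₁ (proj₂ (Forth.transferDom forth S dom))
    upper : ∣ S₂ ∣ ≤ γ + a
    upper = subst₂ _≤_ (+-identityʳ _) (cong (_+ a) ∣S∣≡γ) (proj₂ (proj₂ (Forth.transferDom forth S dom)))
    lower : ∀ S′ → TwoDominating G₂ S′ → γ + a ≤ ∣ S′ ∣
    lower S′ dom′ with Back.transferDom back S′ dom′
    ... | S″ , dom″ , cheaper = ≤-trans (+-monoˡ-≤ a (minimal S″ dom″)) (subst (_ ≤_) (+-identityʳ _) cheaper)

  alpha-shift : ∀ {a α} → IndExchange L₁ w₁ L₂ w₂ 0 a → IndExchange L₂ w₂ L₁ w₁ a 0 →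
    IsAlpha2 G₁ α → IsAlpha2 G₂ (α + a)
  alpha-shift {a} {α} forth back ((S , ind , ∣S∣≡α) , maximal) =
    (S₂ , ind₂ , ≤-antisym (upper S₂ ind₂) lower) , upper
    where
    S₂ : Subset N₂
    S₂ = proj₁ (Forth.transferInd forth S ind)
    ind₂ : TwoIndependent G₂ S₂
    ind₂ = proj₁ (proj₂ (Forth.transferInd forth S ind))
    lower : α + a ≤ ∣ S₂ ∣
    lower = subst₂ _≤_ (cong (_+ a) ∣S∣≡α) (+-identityʳ _) (proj₂ (proj₂ (Forth.transferInd forth S ind)))
    upper : ∀ S′ → TwoIndependent G₂ S′ → ∣ S′ ∣ ≤ α + a
    upper S′ ind′ with Back.transferInd back S′ ind′
    ... | S″ , ind″ , larger = ≤-trans (subst (_≤ _) (+-identityʳ _) larger) (+-monoˡ-≤ a (maximal S″ ind″))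

  exchange : ∀ {a} → Exchangeable L₁ w₁ L₂ w₂ a → γ₂≡α₂ G₁ → γ₂≡α₂ G₂
  exchange {a} ex (k , gamma , alpha) =
    k + a , gamma-shift dom-up dom-down gamma , alpha-shift ind-up ind-down alpha
    where open Exchangeable ex

data Block (n m : ℕ) : Fin (n + m) → Set where
  old : ∀ i → Block n m (i ↑ˡ m)
  new : ∀ j → Block n m (n ↑ʳ j)

block : ∀ n m y → Block n m y
block n m y with splitAt n y in eq
... | inj₁ i = subst (Block n m) (splitAt⁻¹-↑ˡ eq) (old i)
... | inj₂ j = subst (Block n m) (splitAt⁻¹-↑ʳ eq) (new j)

↑ʳ≢↑ˡ : ∀ {n m} (j : Fin m) (i : Fin n) → n ↑ʳ j ≢ i ↑ˡ m
↑ʳ≢↑ˡ {n} {m} j i e with () ← trans (sym (splitAt-↑ʳ n m j)) (trans (cong (splitAt n) e) (splitAt-↑ˡ n i m))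

module _ {n} m (G : Graph n) (C : Fin n → Fin m → Bool) (H : Graph m) where
  extend-oo : ∀ x y → extend m G C H (x ↑ˡ m) (y ↑ˡ m) ≡ G x y
  extend-oo x y rewrite splitAt-↑ˡ n x m | splitAt-↑ˡ n y m = refl

  extend-on : ∀ x j → extend m G C H (x ↑ˡ m) (n ↑ʳ j) ≡ C x j
  extend-on x j rewrite splitAt-↑ˡ n x m | splitAt-↑ʳ n m j = refl

  extend-no : ∀ j y → extend m G C H (n ↑ʳ j) (y ↑ˡ m) ≡ C y j
  extend-no j y rewrite splitAt-↑ʳ n m j | splitAt-↑ˡ n y m = refl

  extend-nn : ∀ i j → extend m G C H (n ↑ʳ i) (n ↑ʳ j) ≡ H i j
  extend-nn i j rewrite splitAt-↑ʳ n m i | splitAt-↑ʳ n m j = refl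

module _ {N} {G : Graph N} {n k} {φ : Fin k → Fin n} {Go att p} (D : Gluing G φ Go att p) where
  open Gluing D

  extendGluing : ∀ m (C : Fin N → Fin m → Bool) (Cl : Fin p → Fin m → Bool) (H : Graph m) →
    (∀ x j → Outside φ x → C (out x) j ≡ false) → (∀ i j → C (loc i) j ≡ Cl i j) →
    Gluing (extend m G C H) φ Go att (p + m)
  extendGluing m C Cl H vanish restrict = record
    { out = out′ ; loc = loc′ ; local = extend m local Cl H ; port = port ↑ˡ m ; side = side′
    ; side-out = side-out′ ; side-loc = side-loc′ ; side∘out = side∘out′ ; side∘loc = side∘loc′
    ; sum-split = sum-split′ ; out-out = out-out′ ; out-loc = out-loc′ ; loc-out = loc-out′ ; loc-loc = loc-loc′ }
    where
    G′ : Graph (N + m)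
    G′ = extend m G C H

    out′ : Fin n → Fin (N + m)
    out′ x = out x ↑ˡ m

    loc′ : Fin (p + m) → Fin (N + m)
    loc′ l = [ (λ i → loc i ↑ˡ m) , (N ↑ʳ_) ]′ (splitAt p l)

    loc′-old : ∀ i → loc′ (i ↑ˡ m) ≡ loc i ↑ˡ m
    loc′-old i rewrite splitAt-↑ˡ p i m = refl

    loc′-new : ∀ j → loc′ (p ↑ʳ j) ≡ N ↑ʳ j
    loc′-new j rewrite splitAt-↑ʳ p m j = refl

    side′ : Fin (N + m) → Fin n ⊎ Fin (p + m)
    side′ y = [ (λ y₀ → Sum.map₂ (_↑ˡ m) (side y₀)) , (λ j → inj₂ (p ↑ʳ j)) ]′ (splitAt N y)

    side′-old : ∀ y₀ → side′ (y₀ ↑ˡ m) ≡ Sum.map₂ (_↑ˡ m) (side y₀)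
    side′-old y₀ rewrite splitAt-↑ˡ N y₀ m = refl

    side′-new : ∀ j → side′ (N ↑ʳ j) ≡ inj₂ (p ↑ʳ j)
    side′-new j rewrite splitAt-↑ʳ N m j = refl

    old-out : ∀ y₀ x → Sum.map₂ (_↑ˡ m) (side y₀) ≡ inj₁ x → y₀ ≡ out x × Outside φ x
    old-out y₀ x e with side y₀ in s
    old-out y₀ x refl | inj₁ .x = side-out y₀ x s

    old-loc : ∀ y₀ l → Sum.map₂ (_↑ˡ m) (side y₀) ≡ inj₂ l → y₀ ↑ˡ m ≡ loc′ l
    old-loc y₀ l e with side y₀ in s
    old-loc y₀ .(i ↑ˡ m) refl | inj₂ i = trans (cong (_↑ˡ m) (side-loc y₀ i s)) (sym (loc′-old i))

    side-out′ : ∀ y x → side′ y ≡ inj₁ x → y ≡ out′ x × Outside φ x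
    side-out′ y x e with block N m y
    ... | old y₀ with y₀≡out , ox ← old-out y₀ x (trans (sym (side′-old y₀)) e) = cong (_↑ˡ m) y₀≡out , ox
    ... | new j with () ← trans (sym e) (side′-new j)

    side-loc′ : ∀ y l → side′ y ≡ inj₂ l → y ≡ loc′ l
    side-loc′ y l e with block N m y
    ... | old y₀ = old-loc y₀ l (trans (sym (side′-old y₀)) e)
    ... | new j with refl ← trans (sym e) (side′-new j) = sym (loc′-new j)

    side∘out′ : ∀ x → Outside φ x → side′ (out′ x) ≡ inj₁ x
    side∘out′ x ox rewrite side′-old (out x) | side∘out x ox = refl

    side∘loc′ : ∀ l → side′ (loc′ l) ≡ inj₂ l
    side∘loc′ l with block p m l
    ... | old i rewrite loc′-old i | side′-old (loc i) | side∘loc i = refl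
    ... | new j rewrite loc′-new j = side′-new j

    sum-split′ : ∀ f → sum f ≡ outsideSum φ (λ x → f (out′ x)) + sum (λ l → f (loc′ l))
    sum-split′ f = begin
      sum f                                                                      ≡⟨ sum-↑ {N} {m} f ⟩
      sum (λ y → f (y ↑ˡ m)) + sum (λ j → f (N ↑ʳ j))                            ≡⟨ cong (_+ sum (λ j → f (N ↑ʳ j))) (sum-split (λ y → f (y ↑ˡ m))) ⟩
      (outside + sum (λ i → f (loc i ↑ˡ m))) + sum (λ j → f (N ↑ʳ j))            ≡⟨ +-assoc outside _ _ ⟩
      outside + (sum (λ i → f (loc i ↑ˡ m)) + sum (λ j → f (N ↑ʳ j)))            ≡⟨ cong (outside +_) (sym blocks) ⟩
      outside + sum (λ l → f (loc′ l))                                           ∎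
      where
      open ≡-Reasoning
      outside : ℕ
      outside = outsideSum φ (λ x → f (out′ x))
      blocks : sum (λ l → f (loc′ l)) ≡ sum (λ i → f (loc i ↑ˡ m)) + sum (λ j → f (N ↑ʳ j))
      blocks = trans (sum-↑ {p} {m} (λ l → f (loc′ l)))
        (cong₂ _+_ (sum-cong-≗ (λ i → cong f (loc′-old i))) (sum-cong-≗ (λ j → cong f (loc′-new j))))

    port-old : ∀ i → ((i ↑ˡ m) ≡ᶠ (port ↑ˡ m)) ≡ (i ≡ᶠ port)
    port-old i = ≡ᶠ-injective (_↑ˡ m) (λ {a} {b} → ↑ˡ-injective m a b) i port

    port-new : ∀ j → ((p ↑ʳ j) ≡ᶠ (port ↑ˡ m)) ≡ false
    port-new j = ≢⇒≡ᶠ-false (↑ʳ≢↑ˡ j port)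

    out-out′ : ∀ x y → Outside φ x → Outside φ y → G′ (out′ x) (out′ y) ≡ Go x y
    out-out′ x y ox oy = trans (extend-oo m G C H (out x) (out y)) (out-out x y ox oy)

    out-loc′ : ∀ x l → Outside φ x → G′ (out′ x) (loc′ l) ≡ att x ∧ (l ≡ᶠ (port ↑ˡ m))
    out-loc′ x l ox with block p m l
    ... | old i rewrite loc′-old i | port-old i = trans (extend-oo m G C H (out x) (loc i)) (out-loc x i ox)
    ... | new j rewrite loc′-new j | port-new j | ∧-zeroʳ (att x) = trans (extend-on m G C H (out x) j) (vanish x j ox)

    loc-out′ : ∀ l x → Outside φ x → G′ (loc′ l) (out′ x) ≡ att x ∧ (l ≡ᶠ (port ↑ˡ m))
    loc-out′ l x ox with block p m l
    ... | old i rewrite loc′-old i | port-old i = trans (extend-oo m G C H (loc i) (out x)) (loc-out i x ox)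
    ... | new j rewrite loc′-new j | port-new j | ∧-zeroʳ (att x) = trans (extend-no m G C H j (out x)) (vanish x j ox)

    loc-loc′ : ∀ l l′ → G′ (loc′ l) (loc′ l′) ≡ extend m local Cl H l l′
    loc-loc′ l l′ with block p m l | block p m l′
    ... | old i | old i′ rewrite loc′-old i | loc′-old i′ =
      trans (extend-oo m G C H (loc i) (loc i′)) (trans (loc-loc i i′) (sym (extend-oo m local Cl H i i′)))
    ... | old i | new j rewrite loc′-old i | loc′-new j =
      trans (extend-on m G C H (loc i) j) (trans (restrict i j) (sym (extend-on m local Cl H i j)))
    ... | new j | old i rewrite loc′-new j | loc′-old i =
      trans (extend-no m G C H j (loc i)) (trans (restrict i j) (sym (extend-no m local Cl H j i)))
    ... | new j | new j′ rewrite loc′-new j | loc′-new j′ =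
      trans (extend-nn m G C H j j′) (sym (extend-nn m local Cl H j j′))

module _ {N} {G : Graph N} {n k} {φ : Fin k → Fin n} {Go att p} (D : Gluing G φ Go att p) where
  open Gluing D

  loc-≡ᶠ : ∀ i j → (loc i ≡ᶠ loc j) ≡ (i ≡ᶠ j)
  loc-≡ᶠ = ≡ᶠ-injective loc loc-injective
    where
    loc-injective : Injective _≡_ _≡_ loc
    loc-injective {i} {j} e with refl ← trans (sym (side∘loc i)) (trans (cong side e) (side∘loc j)) = refl

  out-≡ᶠ-loc : ∀ x i → Outside φ x → (out x ≡ᶠ loc i) ≡ false
  out-≡ᶠ-loc x i ox = ≢⇒≡ᶠ-false λ e → case (trans (sym (side∘out x ox)) (trans (cong side e) (side∘loc i)))
    where
    case : ∀ {a b} → inj₁ a ≢ inj₂ b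
    case ()

  removeGluing : ∀ i₁ i₂ → Gluing (removeEdge G (loc i₁) (loc i₂)) φ Go att p
  removeGluing i₁ i₂ = record
    { out = out ; loc = loc ; port = port ; side = side
    ; side-out = side-out ; side-loc = side-loc ; side∘out = side∘out ; side∘loc = side∘loc ; sum-split = sum-split
    ; local = removeEdge local i₁ i₂
    ; out-out = λ x y ox oy → trans (kept (out x) (out y) (out-≡ᶠ-loc x i₁ ox) (out-≡ᶠ-loc x i₂ ox)) (out-out x y ox oy)
    ; out-loc = λ x i ox → trans (kept (out x) (loc i) (out-≡ᶠ-loc x i₁ ox) (out-≡ᶠ-loc x i₂ ox)) (out-loc x i ox)
    ; loc-out = λ i x ox → trans (kept′ (loc i) (out x) (out-≡ᶠ-loc x i₁ ox) (out-≡ᶠ-loc x i₂ ox)) (loc-out i x ox)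
    ; loc-loc = λ i j → cong₂ (λ e r → e ∧ not r) (loc-loc i j)
                  (cong₂ _∨_ (cong₂ _∧_ (loc-≡ᶠ i i₁) (loc-≡ᶠ j i₂)) (cong₂ _∧_ (loc-≡ᶠ i i₂) (loc-≡ᶠ j i₁)))
    }
    where
    kept : ∀ a b → (a ≡ᶠ loc i₁) ≡ false → (a ≡ᶠ loc i₂) ≡ false → removeEdge G (loc i₁) (loc i₂) a b ≡ G a b
    kept a b a≢i₁ a≢i₂ rewrite a≢i₁ | a≢i₂ = ∧-identityʳ (G a b)
    kept′ : ∀ a b → (b ≡ᶠ loc i₁) ≡ false → (b ≡ᶠ loc i₂) ≡ false → removeEdge G (loc i₁) (loc i₂) a b ≡ G a b
    kept′ a b b≢i₁ b≢i₂ rewrite b≢i₁ | b≢i₂ | ∧-zeroʳ (a ≡ᶠ loc i₁) | ∧-zeroʳ (a ≡ᶠ loc i₂) = ∧-identityʳ (G a b)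

  -- Attaching m new vertices to the port-graph vertices v₁, v₂ in a pattern A
  -- (new vertex j is adjacent to loc v₁ iff A true false j, to loc v₂ iff A false true j).
  attach : ∀ m (A : Bool → Bool → Fin m → Bool) (H : Graph m) (v₁ v₂ : Fin p) → (∀ j → A false false j ≡ false) →
    Gluing (extend m G (λ y j → A (y ≡ᶠ loc v₁) (y ≡ᶠ loc v₂) j) H) φ Go att (p + m)
  attach m A H v₁ v₂ unattached = extendGluing D m _ (λ i j → A (i ≡ᶠ v₁) (i ≡ᶠ v₂) j) H
    (λ x j ox → trans (cong₂ (λ b₁ b₂ → A b₁ b₂ j) (out-≡ᶠ-loc x v₁ ox) (out-≡ᶠ-loc x v₂ ox)) (unattached j))
    (λ i j → cong₂ (λ b₁ b₂ → A b₁ b₂ j) (loc-≡ᶠ i v₁) (loc-≡ᶠ i v₂))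

selfGluing : ∀ {n k} (G : Graph n) (φ : Fin k → Fin n) → Injective _≡_ _≡_ φ → (w : Fin k) →
  (∀ a b → G a b ≡ G b a) → (∀ i x → i ≢ w → Outside φ x → G (φ i) x ≡ false) →
  Gluing G φ G (λ x → G x (φ w)) k
selfGluing {n} {k} G φ inj w symmetric closed = record
  { out = λ x → x ; loc = φ ; local = λ i j → G (φ i) (φ j) ; port = w ; side = side
  ; side-out = side-out ; side-loc = side-loc ; side∘out = λ x ox → cong (Maybe.maybe′ inj₂ (inj₁ x)) ox
  ; side∘loc = λ i → cong (Maybe.maybe′ inj₂ (inj₁ (φ i))) (preimage-image φ inj i)
  ; sum-split = sum-image φ inj ; out-out = λ _ _ _ _ → refl
  ; out-loc = λ x i ox → trans (symmetric x (φ i)) (loc-out i x ox) ; loc-out = loc-out ; loc-loc = λ _ _ → refl }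
  where
  side : Fin n → Fin n ⊎ Fin k
  side y = Maybe.maybe′ inj₂ (inj₁ y) (preimage φ y)
  side-out : ∀ y x → side y ≡ inj₁ x → y ≡ x × Outside φ x
  side-out y x e with preimage φ y in eq
  side-out y .y refl | nothing = refl , eq
  side-loc : ∀ y i → side y ≡ inj₂ i → y ≡ φ i
  side-loc y i e with preimage φ y in eq
  side-loc y .j refl | just j = sym (preimage-just φ y j eq)
  loc-out : ∀ i x → Outside φ x → G (φ i) x ≡ G x (φ w) ∧ (i ≡ᶠ w)
  loc-out i x ox with i ≡ᶠ w in i≟w
  ... | true rewrite ≡ᶠ⇒≡ i≟w = trans (symmetric (φ w) x) (sym (∧-identityʳ _))
  ... | false = trans (closed i x (λ { refl → case (trans (sym i≟w) (≡ᶠ-refl i)) }) ox) (sym (∧-zeroʳ _))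
    where
    case : false ≢ true
    case ()

-- The six operations, performed at port-graph vertices of a gluing, are again gluings; their
-- port graphs arise from the old one by the same operation.
module _ {N} {G : Graph N} {n k} {φ : Fin k → Fin n} {Go att p} (D : Gluing G φ Go att p) where
  open Gluing D

  op₁Gluing : ∀ v → Gluing (op₁ G (loc v)) φ Go att (p + 1)
  op₁Gluing v = attach D 1 (λ b _ _ → b) H₁ v v (λ _ → refl)

  op₂Gluing : ∀ v → Gluing (op₂ G (loc v)) φ Go att (p + 2)
  op₂Gluing v = attach D 2 (λ b _ j → b ∧ (j ≡ᶠ (# 0))) H₂ v v (λ _ → refl)

  op₃Gluing : ∀ v → Gluing (op₃ G (loc v)) φ Go att (p + 3)
  op₃Gluing v = attach D 3 (λ b _ j → b ∧ (j ≡ᶠ (# 1))) H₃ v v (λ _ → refl)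

  op₄Gluing : ∀ v → Gluing (op₄ G (loc v)) φ Go att (p + 3)
  op₄Gluing v = attach D 3 (λ b _ j → b ∧ (j ≡ᶠ (# 0))) H₃ v v (λ _ → refl)

  op₅Gluing : ∀ v₁ v₂ → Gluing (op₅ G (loc v₁) (loc v₂)) φ Go att (p + 3)
  op₅Gluing v₁ v₂ = attach D 3 (λ b₁ b₂ j → (b₁ ∧ (j ≡ᶠ (# 0))) ∨ (b₂ ∧ (j ≡ᶠ (# 1)))) H₃′ v₁ v₂ (λ _ → refl)

  op₆Gluing : ∀ v₁ v₂ → Gluing (op₆ G (loc v₁) (loc v₂)) φ Go att (p + 3)
  op₆Gluing v₁ v₂ = attach (removeGluing D v₁ v₂) 3 (λ b₁ b₂ j → (b₁ ∧ (j ≡ᶠ (# 0))) ∨ (b₂ ∧ (j ≡ᶠ (# 1)))) H₃ v₁ v₂ (λ _ → refl)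

-- Black vertices of a PDI-subtree keep their degree, so all their neighbours lie inside it.
pdi-closed : ∀ {n} {G : Graph n} (P : SpecialTree) (e : PDI P G) →
  ∀ i x → i ≢ white P → Outside (φ e) x → G (φ e i) x ≡ false
pdi-closed {n} {G} P e i x i-black ox = bit≡0 (outsideSum≡0⇒ (φ e) _ nothing-outside x ox)
  where
  bit≡0 : ∀ {b} → bit b ≡ 0 → b ≡ false
  bit≡0 {false} _ = refl
  degree-split : deg G (φ e i) ≡ outsideSum (φ e) (λ y → bit (G (φ e i) y)) + deg (adj P) i
  degree-split = trans (countᵛ≡sum (G (φ e i))) (trans (sum-image (φ e) (φ-inj e) _)
    (cong (outsideSum (φ e) (λ y → bit (G (φ e i) y)) +_) (trans (sum-cong-≗ (λ j → cong bit (induced e i j))) (sym (countᵛ≡sum (adj P i))))))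
  nothing-outside : outsideSum (φ e) (λ y → bit (G (φ e i) y)) ≡ 0
  nothing-outside = +-cancelʳ-≡ (deg (adj P) i) _ 0 (trans (sym degree-split) (black e i i-black))

pdiGluing : ∀ {n} {G : Graph n} (P : SpecialTree) (e : PDI P G) → (∀ a b → G a b ≡ G b a) →
  Gluing G (φ e) G (λ x → G x (φ e (white P))) (size P)
pdiGluing {G = G} P e symmetric =
  relocal (selfGluing G (φ e) (φ-inj e) (white P) symmetric (pdi-closed P e)) (adj P) (induced e)

vertexGluing : ∀ {n} (G : Graph n) (v : Fin n) → IsSimple G → Gluing G (λ _ → v) G (λ x → G x v) 1
vertexGluing G v (symmetric , irreflexive) =
  relocal (selfGluing G (λ _ → v) (λ { {zero} {zero} _ → refl }) zero symmetric
            (λ { zero x 0≢0 _ → ⊥-elim (0≢0 refl) }))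
          H₁ (λ { zero zero → irreflexive v })

-- Port graphs are frozen into tables before being checked, so that the computation shares
-- the evaluation of their adjacency.
table : ∀ {p} → Vec (Vec Bool p) p → Graph p
table t i j = lookup (lookup t i) j

freeze : ∀ {p} → Graph p → Graph p
freeze L = table (tabulate (λ i → tabulate (λ j → L i j)))

frozen : ∀ {N} {G : Graph N} {n k} {φ : Fin k → Fin n} {Go att p} → Gluing G φ Go att p → Gluing G φ Go att p
frozen D = relocal D (freeze (Gluing.local D)) same
  where
  same : ∀ i j → Gluing.local D i j ≡ freeze (Gluing.local D) i j
  same i j = sym (trans (cong (λ r → lookup r j) (lookup∘tabulate _ i)) (lookup∘tabulate _ j))

replace : ∀ {N₁ N₂} {G₁ : Graph N₁} {G₂ : Graph N₂} {n k} {φ : Fin k → Fin n} {Go att p₁ p₂}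
  (D₁ : Gluing G₁ φ Go att p₁) (D₂ : Gluing G₂ φ Go att p₂) {a} →
  Exchangeable (freeze (Gluing.local D₁)) (Gluing.port D₁) (freeze (Gluing.local D₂)) (Gluing.port D₂) a →
  γ₂≡α₂ G₁ → γ₂≡α₂ G₂
replace D₁ D₂ = Exchange.exchange (frozen D₁) (frozen D₂)

module Relabel {n} (π : Permutation n n) (G H : Graph n) (H≡ : ∀ a b → H a b ≡ G (π ⟨$⟩ʳ a) (π ⟨$⟩ʳ b)) where
  pull : Subset n → Subset n
  pull S = tabulate (λ a → lookup S (π ⟨$⟩ʳ a))

  lookup-pull : ∀ S a → lookup (pull S) a ≡ lookup S (π ⟨$⟩ʳ a)
  lookup-pull S a = lookup∘tabulate _ a

  card : ∀ S → ∣ pull S ∣ ≡ ∣ S ∣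
  card S = trans (∣∣≡sum (pull S)) (trans (sum-cong-≗ (λ a → cong bit (lookup-pull S a)))
             (trans (sym (∑-permute (λ b → bit (lookup S b)) π)) (sym (∣∣≡sum S))))

  nbrs : ∀ S a → nbrsIn H (pull S) a ≡ nbrsIn G S (π ⟨$⟩ʳ a)
  nbrs S a = trans (nbrsIn≡sum H (pull S) a) (trans
    (sum-cong-≗ (λ b → cong₂ (λ e s → bit (e ∧ s)) (H≡ a b) (lookup-pull S b)))
    (trans (sym (∑-permute (λ b → bit (G (π ⟨$⟩ʳ a) b ∧ lookup S b)) π)) (sym (nbrsIn≡sum G S _))))

  dom : ∀ S → TwoDominating G S → TwoDominating H (pull S)
  dom S d a a∉ = subst (2 ≤_) (sym (nbrs S a)) (d _ (λ a∈ → a∉ (trans (lookup-pull S a) a∈)))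

  ind : ∀ S → TwoIndependent G S → TwoIndependent H (pull S)
  ind S i a a∈ = subst (_≤ 1) (sym (nbrs S a)) (i _ (trans (sym (lookup-pull S a)) a∈))

relabel-γ₂≡α₂ : ∀ {n} (π : Permutation n n) (G H : Graph n) → (∀ a b → H a b ≡ G (π ⟨$⟩ʳ a) (π ⟨$⟩ʳ b)) →
  γ₂≡α₂ G → γ₂≡α₂ H
relabel-γ₂≡α₂ π G H H≡ (k , ((S , d , ∣S∣≡k) , minimal) , ((I , i , ∣I∣≡k) , maximal)) =
  k , ((Forth.pull S , Forth.dom S d , trans (Forth.card S) ∣S∣≡k) ,
       λ S′ d′ → subst (k ≤_) (Back.card S′) (minimal (Back.pull S′) (Back.dom S′ d′))) ,
      ((Forth.pull I , Forth.ind I i , trans (Forth.card I) ∣I∣≡k) ,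
       λ I′ i′ → subst (_≤ k) (Back.card I′) (maximal (Back.pull I′) (Back.ind I′ i′)))
  where
  module Forth = Relabel π G H H≡
  G≡ : ∀ a b → G a b ≡ H (Perm.flip π ⟨$⟩ʳ a) (Perm.flip π ⟨$⟩ʳ b)
  G≡ a b = sym (trans (H≡ _ _) (cong₂ G (inverseʳ π) (inverseʳ π)))
  module Back = Relabel (Perm.flip π) H G G≡

γ₂≡α₂-cong : ∀ {n} {G H : Graph n} → (∀ a b → H a b ≡ G a b) → γ₂≡α₂ G → γ₂≡α₂ H
γ₂≡α₂-cong {G = G} {H} = relabel-γ₂≡α₂ Perm.id G H

relabel-simple : ∀ {n} (π : Permutation n n) {G H : Graph n} → (∀ a b → H a b ≡ G (π ⟨$⟩ʳ a) (π ⟨$⟩ʳ b)) →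
  IsSimple G → IsSimple H
relabel-simple π H≡ (symmetric , irreflexive) =
  (λ a b → trans (H≡ a b) (trans (symmetric _ _) (sym (H≡ b a)))) , (λ a → trans (H≡ a a) (irreflexive _))

extend-simple : ∀ {n} m (G : Graph n) C (H : Graph m) → IsSimple G → IsSimple H → IsSimple (extend m G C H)
extend-simple {n} m G C H (symG , irrG) (symH , irrH) = symmetric , irreflexive
  where
  symmetric : ∀ a b → extend m G C H a b ≡ extend m G C H b a
  symmetric a b with block n m a | block n m b
  ... | old x | old y = trans (extend-oo m G C H x y) (trans (symG x y) (sym (extend-oo m G C H y x)))
  ... | old x | new j = trans (extend-on m G C H x j) (sym (extend-no m G C H j x))
  ... | new j | old y = trans (extend-no m G C H j y) (sym (extend-on m G C H y j))
  ... | new i | new j = trans (extend-nn m G C H i j) (trans (symH i j) (sym (extend-nn m G C H j i)))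
  irreflexive : ∀ a → extend m G C H a a ≡ false
  irreflexive a with block n m a
  ... | old x = trans (extend-oo m G C H x x) (irrG x)
  ... | new j = trans (extend-nn m G C H j j) (irrH j)

removeEdge-simple : ∀ {n} (G : Graph n) v₁ v₂ → IsSimple G → IsSimple (removeEdge G v₁ v₂)
removeEdge-simple G v₁ v₂ (symmetric , irreflexive) = symmetric′ , irreflexive′
  where
  symmetric′ : ∀ a b → removeEdge G v₁ v₂ a b ≡ removeEdge G v₁ v₂ b a
  symmetric′ a b rewrite symmetric a b | ∨-comm ((a ≡ᶠ v₁) ∧ (b ≡ᶠ v₂)) ((a ≡ᶠ v₂) ∧ (b ≡ᶠ v₁))
                       | ∧-comm (a ≡ᶠ v₂) (b ≡ᶠ v₁) | ∧-comm (a ≡ᶠ v₁) (b ≡ᶠ v₂) = refl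
  irreflexive′ : ∀ a → removeEdge G v₁ v₂ a a ≡ false
  irreflexive′ a rewrite irreflexive a = refl

simple? : ∀ {n} (G : Graph n) → Dec (IsSimple G)
simple? G = allFin? (λ a → allFin? (λ b → G a b ≟ᵇ G b a)) ×-dec allFin? (λ a → G a a ≟ᵇ false)

H₁-simple : IsSimple H₁
H₁-simple = witness {a? = simple? H₁} refl

H₂-simple : IsSimple H₂
H₂-simple = witness {a? = simple? H₂} refl

H₃-simple : IsSimple H₃
H₃-simple = witness {a? = simple? H₃} refl

H₃′-simple : IsSimple H₃′
H₃′-simple = witness {a? = simple? H₃′} refl

-- A certified check of γ₂(G) = α₂(G): a proposed smallest 2-dominating set and a proposed
-- largest 2-independent set of the same size, each verified against all subsets.
module Balance {n} (G : Graph n) where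
  twoDominating? : Decidable (TwoDominating G)
  twoDominating? S = allFin? (λ x → ¬? (x ∈ˢ? S) →-dec (2 ≤? nbrsIn G S x))

  twoIndependent? : Decidable (TwoIndependent G)
  twoIndependent? S = allFin? (λ x → (x ∈ˢ? S) →-dec (nbrsIn G S x ≤? 1))

  module Least = Certificate {P = TwoDominating G} {Q = TwoDominating G} {R = λ S D → ∣ D ∣ ≤ ∣ S ∣}
                   twoDominating? twoDominating? (λ S D → ∣ D ∣ ≤? ∣ S ∣)
  module Most = Certificate {P = TwoIndependent G} {Q = TwoIndependent G} {R = λ S I → ∣ S ∣ ≤ ∣ I ∣}
                  twoIndependent? twoIndependent? (λ S I → ∣ S ∣ ≤? ∣ I ∣)

  balancedFor : Maybe (Subset n) → Maybe (Subset n) → Bool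
  balancedFor (just D) (just I) = ⌊ Least.uniform? D ×-dec Most.uniform? I ×-dec (∣ D ∣ ≟ℕ ∣ I ∣) ⌋
  balancedFor _ _ = false

  balanced? : Bool
  balanced? = balancedFor (Least.proposal _<ᵇ_) (Most.proposal (λ x y → y <ᵇ x))

  balancedFor-sound : ∀ m₁ m₂ → balancedFor m₁ m₂ ≡ true → γ₂≡α₂ G
  balancedFor-sound (just D) (just I) ok
    with (dominating , least) , (independent , most) , ∣D∣≡∣I∣ ← witness {a? = Least.uniform? D ×-dec Most.uniform? I ×-dec (∣ D ∣ ≟ℕ ∣ I ∣)} ok
    = ∣ D ∣ , ((D , dominating , refl) , least) ,
      ((I , independent , sym ∣D∣≡∣I∣) , λ S i → subst (∣ S ∣ ≤_) (sym ∣D∣≡∣I∣) (most S i))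

  balanced-sound : balanced? ≡ true → γ₂≡α₂ G
  balanced-sound = balancedFor-sound (Least.proposal _<ᵇ_) (Most.proposal (λ x y → y <ᵇ x))

-- Every simple graph is rebuilt by repeatedly adding a vertex with a prescribed neighbourhood.
cone : ∀ {n} → Subset n → Graph n → Graph (suc n)
cone r G zero zero = false
cone r G zero (suc j) = lookup r j
cone r G (suc i) zero = lookup r i
cone r G (suc i) (suc j) = G i j

empty : Graph 0
empty ()

rebuild : ∀ {n} → Graph n → Graph n
rebuild {zero} G = empty
rebuild {suc n} G = cone (tabulate (λ j → G zero (suc j))) (rebuild (λ i j → G (suc i) (suc j)))

rebuild-simple : ∀ {n} (G : Graph n) → IsSimple G → ∀ a b → G a b ≡ rebuild G a b
rebuild-simple {suc n} G (symmetric , irreflexive) zero zero = irreflexive zero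
rebuild-simple {suc n} G simple zero (suc j) = sym (lookup∘tabulate _ j)
rebuild-simple {suc n} G (symmetric , irreflexive) (suc i) zero = trans (symmetric (suc i) zero) (sym (lookup∘tabulate _ i))
rebuild-simple {suc n} G (symmetric , irreflexive) (suc i) (suc j) =
  rebuild-simple (λ a b → G (suc a) (suc b)) ((λ a b → symmetric (suc a) (suc b)) , (λ a → irreflexive (suc a))) i j

allCones : ∀ n → (Graph n → Bool) → Bool
allCones zero P = P empty
allCones (suc n) P = allCones n (λ G → ⌊ allSubsets? (λ r → P (cone r G) ≟ᵇ true) ⌋)

allCones-sound : ∀ n P → allCones n P ≡ true → ∀ G → P (rebuild G) ≡ true
allCones-sound zero P ok G = ok
allCones-sound (suc n) P ok G =
  witness {a? = allSubsets? (λ r → P (cone r G′) ≟ᵇ true)} (allCones-sound n _ ok (λ i j → G (suc i) (suc j)))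
    (tabulate (λ j → G zero (suc j)))
  where
  G′ : Graph n
  G′ = rebuild (λ i j → G (suc i) (suc j))

small-γ₂≡α₂ : ∀ {n} (G : Graph n) → n ≤ 4 → IsSimple G → γ₂≡α₂ G
small-γ₂≡α₂ {n} G n≤4 simple = γ₂≡α₂-cong (rebuild-simple G simple)
  (Balance.balanced-sound (rebuild G) (allCones-sound n Balance.balanced? (checked n≤4) G))
  where
  checked : ∀ {n} → n ≤ 4 → allCones n Balance.balanced? ≡ true
  checked z≤n = refl
  checked (s≤s z≤n) = refl
  checked (s≤s (s≤s z≤n)) = refl
  checked (s≤s (s≤s (s≤s z≤n))) = refl
  checked (s≤s (s≤s (s≤s (s≤s z≤n)))) = refl

certificate₁ : ∀ {P v} → Allowed₁ P v →
  Exchangeable (freeze (adj P)) (white P) (freeze (op₁ (adj P) v)) (white P ↑ˡ 1) 1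
certificate₁ a-T1 = exchangeable-sound _ _ _ _ _ refl
certificate₁ a-T2 = exchangeable-sound _ _ _ _ _ refl
certificate₁ a-T8 = exchangeable-sound _ _ _ _ _ refl

certificate₂ : ∀ {P v} → Allowed₂ P v →
  Exchangeable (freeze (adj P)) (white P) (freeze (op₂ (adj P) v)) (white P ↑ˡ 2) 1
certificate₂ a-T4 = exchangeable-sound _ _ _ _ _ refl
certificate₂ a-T11 = exchangeable-sound _ _ _ _ _ refl
certificate₂ a-T12 = exchangeable-sound _ _ _ _ _ refl
certificate₂ a-T13 = exchangeable-sound _ _ _ _ _ refl
certificate₂ a-T15 = exchangeable-sound _ _ _ _ _ refl

certificate₃ : Exchangeable (freeze H₁) zero (freeze (op₃ H₁ zero)) (zero {0} ↑ˡ 3) 2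
certificate₃ = exchangeable-sound _ _ _ _ _ refl

certificate₄ : ∀ {P v} → Allowed₄ P v →
  Exchangeable (freeze (adj P)) (white P) (freeze (op₄ (adj P) v)) (white P ↑ˡ 3) 2
certificate₄ a-T1 = exchangeable-sound _ _ _ _ _ refl
certificate₄ a-T2 = exchangeable-sound _ _ _ _ _ refl
certificate₄ a-T3 = exchangeable-sound _ _ _ _ _ refl
certificate₄ a-T5 = exchangeable-sound _ _ _ _ _ refl
certificate₄ a-T6 = exchangeable-sound _ _ _ _ _ refl
certificate₄ a-T7 = exchangeable-sound _ _ _ _ _ refl
certificate₄ a-T9 = exchangeable-sound _ _ _ _ _ refl
certificate₄ a-T10 = exchangeable-sound _ _ _ _ _ refl

certificate₅ : Exchangeable (freeze (adj T6)) (white T6) (freeze (op₅ (adj T6) (# 0) (# 4))) (white T6 ↑ˡ 3) 2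
certificate₅ = exchangeable-sound _ _ _ _ _ refl

certificate₆ : Exchangeable (freeze (adj T14)) (white T14) (freeze (op₆ (adj T14) (# 0) (# 1))) (white T14 ↑ˡ 3) 2
certificate₆ = exchangeable-sound _ _ _ _ _ refl

O₁-step : ∀ {n} {G : Graph n} P v → Allowed₁ P v → (e : PDI P G) → IsSimple G → γ₂≡α₂ G → γ₂≡α₂ (op₁ G (φ e v))
O₁-step {G = G} P v allowed e (symmetric , _) = replace D (op₁Gluing D v) (certificate₁ allowed)
  where
  D : Gluing G (φ e) G (λ x → G x (φ e (white P))) (size P)
  D = pdiGluing P e symmetric

O₂-step : ∀ {n} {G : Graph n} P v → Allowed₂ P v → (e : PDI P G) → IsSimple G → γ₂≡α₂ G → γ₂≡α₂ (op₂ G (φ e v))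
O₂-step {G = G} P v allowed e (symmetric , _) = replace D (op₂Gluing D v) (certificate₂ allowed)
  where
  D : Gluing G (φ e) G (λ x → G x (φ e (white P))) (size P)
  D = pdiGluing P e symmetric

O₃-step : ∀ {n} {G : Graph n} v → IsSimple G → γ₂≡α₂ G → γ₂≡α₂ (op₃ G v)
O₃-step {G = G} v simple = replace D (op₃Gluing D zero) certificate₃
  where
  D : Gluing G (λ _ → v) G (λ x → G x v) 1
  D = vertexGluing G v simple

O₄-step : ∀ {n} {G : Graph n} P v → Allowed₄ P v → (e : PDI P G) → IsSimple G → γ₂≡α₂ G → γ₂≡α₂ (op₄ G (φ e v))
O₄-step {G = G} P v allowed e (symmetric , _) = replace D (op₄Gluing D v) (certificate₄ allowed)
  where
  D : Gluing G (φ e) G (λ x → G x (φ e (white P))) (size P)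
  D = pdiGluing P e symmetric

O₅-step : ∀ {n} {G : Graph n} (e : PDI T6 G) → IsSimple G → γ₂≡α₂ G → γ₂≡α₂ (op₅ G (φ e (# 0)) (φ e (# 4)))
O₅-step {G = G} e (symmetric , _) = replace D (op₅Gluing D (# 0) (# 4)) certificate₅
  where
  D : Gluing G (φ e) G (λ x → G x (φ e (white T6))) (size T6)
  D = pdiGluing T6 e symmetric

O₆-step : ∀ {n} {G : Graph n} (e : PDI T14 G) → IsSimple G → γ₂≡α₂ G → γ₂≡α₂ (op₆ G (φ e (# 0)) (φ e (# 1)))
O₆-step {G = G} e (symmetric , _) = replace D (op₆Gluing D (# 0) (# 1)) certificate₆
  where
  D : Gluing G (φ e) G (λ x → G x (φ e (white T14))) (size T14)
  D = pdiGluing T14 e symmetric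

simple-γ₂≡α₂ : ∀ {n} (T : Graph n) → InT n T → IsSimple T × γ₂≡α₂ T
simple-γ₂≡α₂ T (base .T small tree) = proj₁ tree , small-γ₂≡α₂ T small (proj₁ tree)
simple-γ₂≡α₂ T (relabel {G = G} .T π T≡ t) with simple-γ₂≡α₂ G t
... | simple , balanced = relabel-simple π T≡ simple , relabel-γ₂≡α₂ π G T T≡ balanced
simple-γ₂≡α₂ _ (O₁ {G = G} P v allowed e t) with simple-γ₂≡α₂ G t
... | simple , balanced = extend-simple 1 G _ H₁ simple H₁-simple , O₁-step P v allowed e simple balanced
simple-γ₂≡α₂ _ (O₂ {G = G} P v allowed e t) with simple-γ₂≡α₂ G t
... | simple , balanced = extend-simple 2 G _ H₂ simple H₂-simple , O₂-step P v allowed e simple balanced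
simple-γ₂≡α₂ _ (O₃ {G = G} v t) with simple-γ₂≡α₂ G t
... | simple , balanced = extend-simple 3 G _ H₃ simple H₃-simple , O₃-step v simple balanced
simple-γ₂≡α₂ _ (O₄ {G = G} P v allowed e t) with simple-γ₂≡α₂ G t
... | simple , balanced = extend-simple 3 G _ H₃ simple H₃-simple , O₄-step P v allowed e simple balanced
simple-γ₂≡α₂ _ (O₅ {G = G} e t) with simple-γ₂≡α₂ G t
... | simple , balanced = extend-simple 3 G _ H₃′ simple H₃′-simple , O₅-step e simple balanced
simple-γ₂≡α₂ _ (O₆ {G = G} e t) with simple-γ₂≡α₂ G t
... | simple , balanced =
  extend-simple 3 _ _ H₃ (removeEdge-simple G _ _ simple) H₃-simple , O₆-step e simple balanced

lemma2 : ∀ {n} (T : Graph n) → InT n T → Σ ℕ λ k → IsGamma2 T k × IsAlpha2 T k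
lemma2 T t = proj₂ (simple-γ₂≡α₂ T t)
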